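{- Let $S$ be a $\Gamma$-complete polyomino. There exists a bijection from the set of X-diagrams of shape $S$ onto the set of $\Gamma$-diagrams of shape $S$ such that every X-diagram $T$ and its image have the same set of zero-rows and the same set of zero-columns.
   Context: A polyomino is a finite set of unit cells $(i,j)$ of the grid, row index $i$ increasing from top to bottom, column index $j$ from left to right. $S$ is $\Gamma$-complete if for all rows $i<j$ and columns $k<l$: whenever $(j,k),(j,l),(i,l)\in S$, also $(i,k)\in S$. A diagram of shape $S$ is a filling of the cells of $S$ with 0s and 1s. It avoids a $2\times2$ pattern $\begin{pmatrix}a&b\\c&d\end{pmatrix}$ if there are no rows $i<i'$ and columns $j<j'$ with all four cells $(i,j),(i,j'),(i',j),(i',j')$ in $S$ carrying entries $a,b,c,d$ respectively. An X-diagram avoids $\begin{pmatrix}1&0\\0&1\end{pmatrix}$ and $\begin{pmatrix}0&1\\1&0\end{pmatrix}$; a $\Gamma$-diagram avoids $\begin{pmatrix}1&1\\1&0\end{pmatrix}$ and $\begin{pmatrix}0&1\\1&0\end{pmatrix}$. A zero-row (resp. zero-column) is a row (resp. column) of $S$ all of whose entries are 0. -}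

module Defs where

open import Data.Nat using (ℕ)
open import Data.Bool using (Bool; true; false)
open import Data.Fin using (Fin; _<_)
open import Data.Vec using (Vec; lookup)
open import Data.Product using (_×_; ∃-syntax)
open import Relation.Nullary using (¬_)
open import Relation.Binary.PropositionalEquality using (_≡_)

-- An m × n Boolean matrix; row index i (top to bottom), column index j.
Matrix : ℕ → ℕ → Set
Matrix m n = Vec (Vec Bool n) m

_[_,_] : ∀ {m n} → Matrix m n → Fin m → Fin n → Bool
M [ i , j ] = lookup (lookup M i) j

-- A polyomino (finite set of cells) is given as its indicator inside an
-- m × n bounding box: cell (i , j) ∈ S iff S [ i , j ] ≡ true.
Polyomino : ℕ → ℕ → Set
Polyomino = Matrix

ΓComplete : ∀ {m n} → Polyomino m n → Set
ΓComplete {m} {n} S =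
  ∀ (i i' : Fin m) (k l : Fin n) → i < i' → k < l →
    S [ i' , k ] ≡ true → S [ i' , l ] ≡ true → S [ i , l ] ≡ true →
    S [ i , k ] ≡ true

-- A diagram of shape S: a 0/1 filling of the cells of S.  Represented as a
-- matrix of the bounding box that is 0 (false) at every cell outside S, so
-- that diagrams of shape S correspond one-to-one to such matrices.
IsDiagram : ∀ {m n} → Polyomino m n → Matrix m n → Set
IsDiagram {m} {n} S T = ∀ (i : Fin m) (j : Fin n) → S [ i , j ] ≡ false → T [ i , j ] ≡ false

Contains : ∀ {m n} → Polyomino m n → Matrix m n → Bool → Bool → Bool → Bool → Set
Contains {m} {n} S T a b c d =
  ∃[ i ] ∃[ i' ] ∃[ j ] ∃[ j' ] (i < i' × j < j' ×
     S [ i , j ] ≡ true × S [ i , j' ] ≡ true × S [ i' , j ] ≡ true × S [ i' , j' ] ≡ true ×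
     T [ i , j ] ≡ a × T [ i , j' ] ≡ b × T [ i' , j ] ≡ c × T [ i' , j' ] ≡ d)

Avoids : ∀ {m n} → Polyomino m n → Matrix m n → Bool → Bool → Bool → Bool → Set
Avoids S T a b c d = ¬ Contains S T a b c d

IsXDiagram : ∀ {m n} → Polyomino m n → Matrix m n → Set
IsXDiagram S T = IsDiagram S T × Avoids S T true false false true × Avoids S T false true true false

IsΓDiagram : ∀ {m n} → Polyomino m n → Matrix m n → Set
IsΓDiagram S T = IsDiagram S T × Avoids S T true true true false × Avoids S T false true true false

ZeroRow : ∀ {m n} → Polyomino m n → Matrix m n → Fin m → Set
ZeroRow {m} {n} S T i = ∀ (j : Fin n) → S [ i , j ] ≡ true → T [ i , j ] ≡ false

ZeroCol : ∀ {m n} → Polyomino m n → Matrix m n → Fin n → Set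
ZeroCol {m} {n} S T j = ∀ (i : Fin m) → S [ i , j ] ≡ true → T [ i , j ] ≡ false

-- The bijection is built cell by cell along the reading order, carrying a
-- Correspondence (mutually inverse maps φ : X → Γ and ψ : Γ → X, φ keeping
-- zero lines).  When the last cell (r , c) is added, Γ-completeness makes
-- the cells above it in column c (the leg) and left of it in row r (the
-- arm) span a full rectangle.  A Γ-diagram of the smaller shape takes corner
-- 1 always and corner 0 iff its arm or leg is zero; an X-diagram takes 1
-- unless "obstructed" and 0 iff its hook is zero, or it is obstructed, or it
-- is Free.  The key combinatorial fact is a bijection unblock/block between
-- Blocked diagrams (zero hook and obstructed) and Free ones, obtained by
-- refilling or clearing the leg and the arm.
module Submission where

open import Defs
open import Data.Nat using (ℕ)
open import Data.Product using (Σ-syntax; _×_)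
open import Function.Bundles using (_⇔_)
open import Relation.Binary.PropositionalEquality using (_≡_)

import Data.Nat as ℕ
import Data.Nat.Properties as ℕP
open import Data.Bool using (Bool; true; false; if_then_else_)
open import Data.Bool.Properties using () renaming (_≟_ to _≟ᵇ_)
open import Data.Fin as F using (Fin; _<_)
import Data.Fin.Properties as FP
open import Data.Vec using (lookup; tabulate)
import Data.Vec.Properties as VP
open import Data.Product using (_,_; proj₁; proj₂; ∃)
open import Data.Product.Function.NonDependent.Propositional using (_×-⇔_)
open import Data.Sum using (_⊎_; inj₁; inj₂; [_,_]′)
open import Data.Empty using (⊥; ⊥-elim)
open import Function using (id; _∘_)
open import Function.Bundles using (mk⇔; Equivalence)
import Function.Properties.Equivalence as ⇔
open import Relation.Nullary using (¬_; Dec; yes; no; does)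
open import Relation.Nullary.Decidable using (_×-dec_; _⊎-dec_; dec-true; dec-false)
open import Relation.Binary using (tri<; tri≈; tri>)
open import Relation.Binary.PropositionalEquality using (refl; sym; trans; cong; cong₂; subst; subst₂; _≢_; module ≡-Reasoning)

bool-cases : (b : Bool) → b ≡ true ⊎ b ≡ false
bool-cases true  = inj₁ refl
bool-cases false = inj₂ refl

clash : ∀ {b} → b ≡ true → b ≡ false → ⊥
clash refl ()

does-true : ∀ {P : Set} (P? : Dec P) → does P? ≡ true → P
does-true (yes p) _ = p

does-false : ∀ {P : Set} (P? : Dec P) → does P? ≡ false → ¬ P
does-false (no ¬p) _ = ¬p

does-reflects : ∀ {P : Set} (P? : Dec P) {b} → (b ≡ true → P) → (P → b ≡ true) → does P? ≡ b
does-reflects P? {true}  b⇒P P⇒b = dec-true P? (b⇒P refl)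
does-reflects P? {false} b⇒P P⇒b = dec-false P? (λ p → clash (P⇒b p) refl)

clause₃ : ∀ (a b d : Bool) → (a ≡ true → b ≡ true → d ≡ true) ⊎ (a ≡ true × b ≡ true × d ≡ false)
clause₃ true  true  false = inj₂ (refl , refl , refl)
clause₃ a     b     true  = inj₁ (λ _ _ → refl)
clause₃ false b     false = inj₁ (λ ())
clause₃ true  false false = inj₁ (λ _ ())

clause₅ : ∀ (a b d e f : Bool) →
  (a ≡ true → b ≡ true → d ≡ true → e ≡ false → f ≡ true) ⊎ (a ≡ true × b ≡ true × d ≡ true × e ≡ false × f ≡ false)
clause₅ true  true  true  false false = inj₂ (refl , refl , refl , refl , refl)
clause₅ a     b     d     e     true  = inj₁ (λ _ _ _ _ → refl)
clause₅ false b     d     e     false = inj₁ (λ ())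
clause₅ true  false d     e     false = inj₁ (λ _ ())
clause₅ true  true  false e     false = inj₁ (λ _ _ ())
clause₅ true  true  true  true  false = inj₁ (λ _ _ _ ())

all-or-witness : ∀ k {P Q : Fin k → Set} → (∀ x → P x ⊎ Q x) → (∀ x → P x) ⊎ ∃ Q
all-or-witness ℕ.zero    f = inj₁ λ ()
all-or-witness (ℕ.suc k) f with f F.zero | all-or-witness k (f ∘ F.suc)
... | inj₂ q | _            = inj₂ (F.zero , q)
... | inj₁ p | inj₂ (x , q) = inj₂ (F.suc x , q)
... | inj₁ p | inj₁ ps      = inj₁ λ { F.zero → p ; (F.suc x) → ps x }

least : ∀ k (J : Fin k → Set) → (∀ x → Dec (J x)) → (R : Fin k → Fin k → Set) →
  (∀ {x y z} → R x y → R y z → R x z) → (∀ x y → J x → J y → R x y ⊎ R y x) →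
  ∃ J → Σ[ x ∈ Fin k ] (J x × (∀ y → J y → R x y))
least ℕ.zero J J? R R-trans R-total (() , _)
least (ℕ.suc k) J J? R R-trans R-total (x₀ , jx₀) = search (J? F.zero) (FP.any? (J? ∘ F.suc))
  where
  reflexive : ∀ {x} → J x → R x x
  reflexive jx = [ id , id ]′ (R-total _ _ jx jx)
  absent : ∀ x → J x → ¬ J F.zero → ¬ ∃ (J ∘ F.suc) → ⊥
  absent F.zero    jx ¬j₀ _    = ¬j₀ jx
  absent (F.suc x) jx _   none = none (x , jx)
  search : Dec (J F.zero) → Dec (∃ (J ∘ F.suc)) → Σ[ x ∈ Fin (ℕ.suc k) ] (J x × (∀ y → J y → R x y))
  search (no ¬j₀) (no none) = ⊥-elim (absent x₀ jx₀ ¬j₀ none)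
  search (yes j₀) (no none) = F.zero , j₀ , λ { F.zero j → reflexive j ; (F.suc y) j → ⊥-elim (none (y , j)) }
  search dj₀ (yes some)
    with least k (J ∘ F.suc) (J? ∘ F.suc) (λ x y → R (F.suc x) (F.suc y)) R-trans (λ x y → R-total (F.suc x) (F.suc y)) some
  ... | x , jx , min with dj₀
  ...   | no ¬j₀ = F.suc x , jx , λ { F.zero j → ⊥-elim (¬j₀ j) ; (F.suc y) j → min y j }
  ...   | yes j₀ with R-total (F.suc x) F.zero jx j₀
  ...     | inj₁ x≤₀ = F.suc x , jx , λ { F.zero _ → x≤₀ ; (F.suc y) j → min y j }
  ...     | inj₂ ₀≤x = F.zero , j₀ , λ { F.zero _ → reflexive j₀ ; (F.suc y) j → R-trans ₀≤x (min y j) }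

matrix : ∀ {m n} → (Fin m → Fin n → Bool) → Matrix m n
matrix f = tabulate (λ i → tabulate (f i))

matrix-entry : ∀ {m n} (f : Fin m → Fin n → Bool) i j → matrix f [ i , j ] ≡ f i j
matrix-entry f i j rewrite VP.lookup∘tabulate (λ i → tabulate (f i)) i = VP.lookup∘tabulate (f i) j

matrix-ext : ∀ {m n} {A B : Matrix m n} → (∀ i j → A [ i , j ] ≡ B [ i , j ]) → A ≡ B
matrix-ext {A = A} {B} A≗B = trans (sym (VP.tabulate∘lookup A)) (trans (VP.tabulate-cong row) (VP.tabulate∘lookup B))
  where
  row : ∀ i → lookup A i ≡ lookup B i
  row i = trans (sym (VP.tabulate∘lookup (lookup A i))) (trans (VP.tabulate-cong (A≗B i)) (VP.tabulate∘lookup (lookup B i)))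

overwrite : ∀ {m n} {R : Fin m → Fin n → Set} → (∀ i j → Dec (R i j)) →
  (Fin m → Fin n → Bool) → Matrix m n → Matrix m n
overwrite R? f M = matrix (λ i j → if does (R? i j) then f i j else M [ i , j ])

overwrite-inside : ∀ {m n} {R : Fin m → Fin n → Set} (R? : ∀ i j → Dec (R i j)) f M {i j} →
  R i j → overwrite R? f M [ i , j ] ≡ f i j
overwrite-inside R? f M {i} {j} rij with R? i j | matrix-entry (λ i j → if does (R? i j) then f i j else M [ i , j ]) i j
... | yes _ | e = e
... | no ¬r | _ = ⊥-elim (¬r rij)

overwrite-outside : ∀ {m n} {R : Fin m → Fin n → Set} (R? : ∀ i j → Dec (R i j)) f M {i j} →
  ¬ R i j → overwrite R? f M [ i , j ] ≡ M [ i , j ]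
overwrite-outside R? f M {i} {j} ¬rij with R? i j | matrix-entry (λ i j → if does (R? i j) then f i j else M [ i , j ]) i j
... | yes r | _ = ⊥-elim (¬rij r)
... | no _  | e = e

overwrite-zero : ∀ {m n} {R : Fin m → Fin n → Set} (R? : ∀ i j → Dec (R i j)) M {i j} →
  M [ i , j ] ≡ false → overwrite R? (λ _ _ → false) M [ i , j ] ≡ false
overwrite-zero R? M {i} {j} mij with R? i j
... | yes rij = overwrite-inside R? _ M rij
... | no ¬rij = trans (overwrite-outside R? _ M ¬rij) mij

-- Both X-patterns are exactly the crossings,
-- and forgetting the order removes all case distinctions on positions.
Crossing : ∀ {m n} → Polyomino m n → Matrix m n → Fin m → Fin m → Fin n → Fin n → Set
Crossing S M a a' x y =
  S [ a , x ] ≡ true × S [ a , y ] ≡ true × S [ a' , x ] ≡ true × S [ a' , y ] ≡ true ×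
  M [ a , x ] ≡ true × M [ a , y ] ≡ false × M [ a' , x ] ≡ false × M [ a' , y ] ≡ true

CrossingFree : ∀ {m n} → Polyomino m n → Matrix m n → Set
CrossingFree {m} {n} S M = ∀ (a a' : Fin m) (x y : Fin n) → ¬ Crossing S M a a' x y

XDiagram : ∀ {m n} → Polyomino m n → Matrix m n → Set
XDiagram S M = IsDiagram S M × CrossingFree S M

XDiagram⇒IsX : ∀ {m n} {S : Polyomino m n} {M} → XDiagram S M → IsXDiagram S M
XDiagram⇒IsX (d , free) = d ,
  (λ { (i , i' , j , j' , _ , _ , s₁ , s₂ , s₃ , s₄ , v₁ , v₂ , v₃ , v₄) → free i i' j j' (s₁ , s₂ , s₃ , s₄ , v₁ , v₂ , v₃ , v₄) }) ,
  (λ { (i , i' , j , j' , _ , _ , s₁ , s₂ , s₃ , s₄ , v₁ , v₂ , v₃ , v₄) → free i i' j' j (s₂ , s₁ , s₄ , s₃ , v₂ , v₁ , v₄ , v₃) })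

IsX⇒XDiagram : ∀ {m n} {S : Polyomino m n} {M} → IsXDiagram S M → XDiagram S M
IsX⇒XDiagram {S = S} {M} (d , no1001 , no0110) = d , free
  where
  free : CrossingFree S M
  free a a' x y (s₁ , s₂ , s₃ , s₄ , v₁ , v₂ , v₃ , v₄) with FP.<-cmp a a' | FP.<-cmp x y
  ... | tri≈ _ refl _ | _             = clash v₁ v₃
  ... | _             | tri≈ _ refl _ = clash v₁ v₂
  ... | tri< a<a' _ _ | tri< x<y _ _  = no1001 (a , a' , x , y , a<a' , x<y , s₁ , s₂ , s₃ , s₄ , v₁ , v₂ , v₃ , v₄)
  ... | tri< a<a' _ _ | tri> _ _ y<x  = no0110 (a , a' , y , x , a<a' , y<x , s₂ , s₁ , s₄ , s₃ , v₂ , v₁ , v₄ , v₃)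
  ... | tri> _ _ a'<a | tri< x<y _ _  = no0110 (a' , a , x , y , a'<a , x<y , s₃ , s₄ , s₁ , s₂ , v₃ , v₄ , v₁ , v₂)
  ... | tri> _ _ a'<a | tri> _ _ y<x  = no1001 (a' , a , y , x , a'<a , y<x , s₄ , s₃ , s₂ , s₁ , v₄ , v₃ , v₂ , v₁)

record SameZeros {m n} (S : Polyomino m n) (A B : Matrix m n) : Set where
  constructor same-zeros
  field
    rows : ∀ i → ZeroRow S A i ⇔ ZeroRow S B i
    cols : ∀ j → ZeroCol S A j ⇔ ZeroCol S B j

SameZeros-sym : ∀ {m n} {S : Polyomino m n} {A B} → SameZeros S A B → SameZeros S B A
SameZeros-sym (same-zeros rows cols) = same-zeros (⇔.sym ∘ rows) (⇔.sym ∘ cols)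

SameZeros-trans : ∀ {m n} {S : Polyomino m n} {A B C} → SameZeros S A B → SameZeros S B C → SameZeros S A C
SameZeros-trans (same-zeros rows cols) (same-zeros rows' cols') =
  same-zeros (λ i → ⇔.trans (rows i) (rows' i)) (λ j → ⇔.trans (cols j) (cols' j))

record Correspondence {m n} (S : Polyomino m n) : Set where
  field
    φ     : Matrix m n → Matrix m n
    ψ     : Matrix m n → Matrix m n
    φ-Γ   : ∀ T → IsXDiagram S T → IsΓDiagram S (φ T)
    ψ-X   : ∀ U → IsΓDiagram S U → IsXDiagram S (ψ U)
    ψ∘φ   : ∀ T → IsXDiagram S T → ψ (φ T) ≡ T
    φ∘ψ   : ∀ U → IsΓDiagram S U → φ (ψ U) ≡ U
    φ-zeros : ∀ T → IsXDiagram S T → SameZeros S T (φ T)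

empty-correspondence : ∀ {m n} (S : Polyomino m n) → (∀ i j → S [ i , j ] ≡ false) → Correspondence S
empty-correspondence S empty = record
  { φ = id ; ψ = id
  ; φ-Γ = λ T x → proj₁ x , no-pattern {T} , no-pattern {T}
  ; ψ-X = λ U γ → proj₁ γ , no-pattern {U} , no-pattern {U}
  ; ψ∘φ = λ _ _ → refl ; φ∘ψ = λ _ _ → refl
  ; φ-zeros = λ _ _ → same-zeros (λ _ → ⇔.refl) (λ _ → ⇔.refl)
  }
  where
  no-pattern : ∀ {M a b c d} → ¬ Contains S M a b c d
  no-pattern (i , _ , j , _ , _ , _ , s , _) = clash s (empty i j)

-- S⁻ is S with its last cell (r , c) in reading order
-- removed.  Γ-completeness of S makes the cells of S⁻ in column c (the leg,
-- all above r) and in row r (the arm, all left of c) span a full rectangle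
-- of S⁻, which is all the geometry the step uses.
module CornerStep {m n : ℕ} (S S⁻ : Polyomino m n) (r : Fin m) (c : Fin n)
  (corner∈S : S [ r , c ] ≡ true) (corner∉S⁻ : S⁻ [ r , c ] ≡ false)
  (S⁻⊆S : ∀ i j → S⁻ [ i , j ] ≡ true → S [ i , j ] ≡ true)
  (S⊆S⁻+corner : ∀ i j → S [ i , j ] ≡ true → (i ≡ r × j ≡ c) ⊎ S⁻ [ i , j ] ≡ true)
  (corner-last : ∀ i j → S [ i , j ] ≡ true → i < r ⊎ (i ≡ r × j F.≤ c))
  (Γcomp : ΓComplete S) where

  IsCorner : Fin m → Fin n → Set
  IsCorner i j = i ≡ r × j ≡ c

  corner? : ∀ i j → Dec (IsCorner i j)
  corner? i j = (i F.≟ r) ×-dec (j F.≟ c)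

  off-row : ∀ {i j} → i ≢ r → ¬ IsCorner i j
  off-row i≢r (i≡r , _) = i≢r i≡r

  off-col : ∀ {i j} → j ≢ c → ¬ IsCorner i j
  off-col j≢c (_ , j≡c) = j≢c j≡c

  Leg : Fin m → Set
  Leg i = S⁻ [ i , c ] ≡ true

  Arm : Fin n → Set
  Arm k = S⁻ [ r , k ] ≡ true

  leg-above : ∀ {i} → Leg i → i < r
  leg-above {i} si with corner-last i c (S⁻⊆S i c si)
  ... | inj₁ i<r        = i<r
  ... | inj₂ (refl , _) = ⊥-elim (clash si corner∉S⁻)

  arm-left : ∀ {k} → Arm k → k < c
  arm-left {k} sk with corner-last r k (S⁻⊆S r k sk)
  ... | inj₁ r<r = ⊥-elim (FP.<-irrefl refl r<r)
  ... | inj₂ (_ , k≤c) with k F.≟ c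
  ...   | yes refl = ⊥-elim (clash sk corner∉S⁻)
  ...   | no k≢c   = FP.≤∧≢⇒< k≤c k≢c

  leg≢r : ∀ {i} → Leg i → i ≢ r
  leg≢r = FP.<⇒≢ ∘ leg-above

  arm≢c : ∀ {k} → Arm k → k ≢ c
  arm≢c = FP.<⇒≢ ∘ arm-left

  hook-fill : ∀ {i k} → Leg i → Arm k → S⁻ [ i , k ] ≡ true
  hook-fill {i} {k} si sk
    with S⊆S⁻+corner i k (Γcomp i r k c (leg-above si) (arm-left sk) (S⁻⊆S r k sk) corner∈S (S⁻⊆S i c si))
  ... | inj₁ (refl , _) = ⊥-elim (FP.<-irrefl refl (leg-above si))
  ... | inj₂ s          = s

  S⁻-off-corner : ∀ {i j} → S⁻ [ i , j ] ≡ true → ¬ IsCorner i j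
  S⁻-off-corner s (refl , refl) = clash s corner∉S⁻

  to-S⁻ : ∀ {i j} → S [ i , j ] ≡ true → ¬ IsCorner i j → S⁻ [ i , j ] ≡ true
  to-S⁻ {i} {j} s ¬corner with S⊆S⁻+corner i j s
  ... | inj₁ corner = ⊥-elim (¬corner corner)
  ... | inj₂ s⁻     = s⁻

  outside-S : ∀ {i j} → S⁻ [ i , j ] ≡ false → ¬ IsCorner i j → S [ i , j ] ≡ false
  outside-S {i} {j} s⁻ ¬corner with bool-cases (S [ i , j ])
  ... | inj₁ s = ⊥-elim (clash (to-S⁻ s ¬corner) s⁻)
  ... | inj₂ s = s

  outside-S⁻ : ∀ {i j} → S [ i , j ] ≡ false → S⁻ [ i , j ] ≡ false
  outside-S⁻ {i} {j} s with bool-cases (S⁻ [ i , j ])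
  ... | inj₁ s⁻ = ⊥-elim (clash (S⁻⊆S i j s⁻) s)
  ... | inj₂ s⁻ = s⁻

  -- Diagrams of S are diagrams of S⁻ together with a value at the corner.
  setCorner : Matrix m n → Bool → Matrix m n
  setCorner M v = overwrite corner? (λ _ _ → v) M

  setCorner-corner : ∀ M v → setCorner M v [ r , c ] ≡ v
  setCorner-corner M v = overwrite-inside corner? _ M (refl , refl)

  setCorner-other : ∀ M v {i j} → ¬ IsCorner i j → setCorner M v [ i , j ] ≡ M [ i , j ]
  setCorner-other M v = overwrite-outside corner? _ M

  from-setCorner : ∀ M v {i j b} → ¬ IsCorner i j → setCorner M v [ i , j ] ≡ b → M [ i , j ] ≡ b
  from-setCorner M v ¬corner = trans (sym (setCorner-other M v ¬corner))

  from-setCorner-S⁻ : ∀ M v {i j b} → S⁻ [ i , j ] ≡ true → setCorner M v [ i , j ] ≡ b → M [ i , j ] ≡ b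
  from-setCorner-S⁻ M v = from-setCorner M v ∘ S⁻-off-corner

  corner-ext : ∀ {A B : Matrix m n} → (∀ {i j} → ¬ IsCorner i j → A [ i , j ] ≡ B [ i , j ]) → A [ r , c ] ≡ B [ r , c ] → A ≡ B
  corner-ext {A} {B} off at = matrix-ext λ i j → pointwise i j
    where
    pointwise : ∀ i j → A [ i , j ] ≡ B [ i , j ]
    pointwise i j with corner? i j
    ... | yes (refl , refl) = at
    ... | no ¬corner        = off ¬corner

  diagram-extend : ∀ M v → IsDiagram S⁻ M → IsDiagram S (setCorner M v)
  diagram-extend M v d i j s with corner? i j
  ... | yes (refl , refl) = ⊥-elim (clash corner∈S s)
  ... | no ¬corner        = trans (setCorner-other M v ¬corner) (d i j (outside-S⁻ s))

  diagram-restrict : ∀ M → IsDiagram S M → IsDiagram S⁻ (setCorner M false)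
  diagram-restrict M d i j s⁻ with corner? i j
  ... | yes (refl , refl) = setCorner-corner M false
  ... | no ¬corner        = trans (setCorner-other M false ¬corner) (d i j (outside-S s⁻ ¬corner))

  setCorner-id : ∀ M → IsDiagram S⁻ M → setCorner M false ≡ M
  setCorner-id M d = corner-ext (setCorner-other M false) (trans (setCorner-corner M false) (sym (d r c corner∉S⁻)))

  restrict : Matrix m n → Matrix m n
  restrict T = setCorner T false

  restore : ∀ T {v} → T [ r , c ] ≡ v → setCorner (restrict T) v ≡ T
  restore T refl = corner-ext (λ ¬corner → trans (setCorner-other (restrict T) _ ¬corner) (setCorner-other T false ¬corner))
                              (setCorner-corner (restrict T) _)

  setCorner-twice : ∀ M v w → setCorner (setCorner M v) w ≡ setCorner M w
  setCorner-twice M v w = corner-ext (λ ¬corner → trans (setCorner-other (setCorner M v) w ¬corner)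
                                                   (trans (setCorner-other M v ¬corner) (sym (setCorner-other M w ¬corner))))
                                     (trans (setCorner-corner (setCorner M v) w) (sym (setCorner-corner M w)))

  -- With
  -- corner 1 the forbidden configuration is Obstr1; with corner 0 it is a
  -- leg entry 1 and an arm entry 1 whose hook cell (i , k) is 0.
  ArmZero LegZero HookZero : Matrix m n → Set
  ArmZero T  = ZeroRow S⁻ T r
  LegZero T  = ZeroCol S⁻ T c
  HookZero T = ArmZero T ⊎ LegZero T

  ArmHit LegHit : Matrix m n → Set
  ArmHit T = Σ[ k ∈ Fin n ] (Arm k × T [ r , k ] ≡ true)
  LegHit T = Σ[ i ∈ Fin m ] (Leg i × T [ i , c ] ≡ true)

  Ext1 Ext0 Obstr1 : Matrix m n → Set
  Ext1 T = ∀ i k → Leg i → Arm k → T [ i , k ] ≡ true → T [ i , c ] ≡ false → T [ r , k ] ≡ true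
  Ext0 T = ∀ i k → Leg i → Arm k → T [ i , c ] ≡ true → T [ r , k ] ≡ true → T [ i , k ] ≡ true
  Obstr1 T = Σ[ i ∈ Fin m ] Σ[ k ∈ Fin n ] (Leg i × Arm k × T [ i , k ] ≡ true × T [ i , c ] ≡ false × T [ r , k ] ≡ false)

  armZero⊎hit : ∀ T → ArmZero T ⊎ ArmHit T
  armZero⊎hit T = all-or-witness n entry
    where
    entry : ∀ k → (Arm k → T [ r , k ] ≡ false) ⊎ (Arm k × T [ r , k ] ≡ true)
    entry k with bool-cases (S⁻ [ r , k ]) | bool-cases (T [ r , k ])
    ... | inj₁ s | inj₁ t = inj₂ (s , t)
    ... | _      | inj₂ t = inj₁ (λ _ → t)
    ... | inj₂ s | inj₁ _ = inj₁ (λ s' → ⊥-elim (clash s' s))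

  legZero⊎hit : ∀ T → LegZero T ⊎ LegHit T
  legZero⊎hit T = all-or-witness m entry
    where
    entry : ∀ i → (Leg i → T [ i , c ] ≡ false) ⊎ (Leg i × T [ i , c ] ≡ true)
    entry i with bool-cases (S⁻ [ i , c ]) | bool-cases (T [ i , c ])
    ... | inj₁ s | inj₁ t = inj₂ (s , t)
    ... | _      | inj₂ t = inj₁ (λ _ → t)
    ... | inj₂ s | inj₁ _ = inj₁ (λ s' → ⊥-elim (clash s' s))

  armHit⇒¬zero : ∀ T → ArmHit T → ¬ ArmZero T
  armHit⇒¬zero T (k , s , t) zero = clash t (zero k s)

  legHit⇒¬zero : ∀ T → LegHit T → ¬ LegZero T
  legHit⇒¬zero T (i , s , t) zero = clash t (zero i s)

  armZero? : ∀ T → Dec (ArmZero T)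
  armZero? T with armZero⊎hit T
  ... | inj₁ zero = yes zero
  ... | inj₂ hit  = no (armHit⇒¬zero T hit)

  legZero? : ∀ T → Dec (LegZero T)
  legZero? T with legZero⊎hit T
  ... | inj₁ zero = yes zero
  ... | inj₂ hit  = no (legHit⇒¬zero T hit)

  hookZero? : ∀ T → Dec (HookZero T)
  hookZero? T = armZero? T ⊎-dec legZero? T

  ¬armZero⇒hit : ∀ T → ¬ ArmZero T → ArmHit T
  ¬armZero⇒hit T ¬zero with armZero⊎hit T
  ... | inj₁ zero = ⊥-elim (¬zero zero)
  ... | inj₂ hit  = hit

  ¬legZero⇒hit : ∀ T → ¬ LegZero T → LegHit T
  ¬legZero⇒hit T ¬zero with legZero⊎hit T
  ... | inj₁ zero = ⊥-elim (¬zero zero)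
  ... | inj₂ hit  = hit

  ext1⊎obstr1 : ∀ T → Ext1 T ⊎ Obstr1 T
  ext1⊎obstr1 T = all-or-witness m λ i → all-or-witness n λ k →
    clause₅ (S⁻ [ i , c ]) (S⁻ [ r , k ]) (T [ i , k ]) (T [ i , c ]) (T [ r , k ])

  ext1⇒¬obstr1 : ∀ T → Ext1 T → ¬ Obstr1 T
  ext1⇒¬obstr1 T ext1 (i , k , si , sk , t₁ , t₂ , t₃) = clash (ext1 i k si sk t₁ t₂) t₃

  ¬obstr1⇒ext1 : ∀ T → ¬ Obstr1 T → Ext1 T
  ¬obstr1⇒ext1 T ¬ob with ext1⊎obstr1 T
  ... | inj₁ ext1 = ext1
  ... | inj₂ ob   = ⊥-elim (¬ob ob)

  obstr1? : ∀ T → Dec (Obstr1 T)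
  obstr1? T with ext1⊎obstr1 T
  ... | inj₁ ext1 = no (ext1⇒¬obstr1 T ext1)
  ... | inj₂ ob   = yes ob

  -- The corner can only be the lower-right cell of a pattern,
  -- and both Γ-patterns have a 0 there; so a corner 1 is always allowed and
  -- a corner 0 exactly when the arm or the leg is zero.
  row-above-corner : ∀ {i i' j} → i < i' → S [ i' , j ] ≡ true → i ≢ r
  row-above-corner {i} {i'} {j} i<i' s refl with corner-last i' j s
  ... | inj₁ i'<i       = FP.<-asym i<i' i'<i
  ... | inj₂ (refl , _) = FP.<-irrefl refl i<i'

  col-left-of-corner : ∀ {i' j j'} → j < j' → S [ i' , j' ] ≡ true → ¬ IsCorner i' j
  col-left-of-corner {i'} {j} {j'} j<j' s (refl , refl) with corner-last i' j' s
  ... | inj₁ r<r        = FP.<-irrefl refl r<r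
  ... | inj₂ (_ , j'≤c) = ℕP.<⇒≱ j<j' j'≤c

  Γ-extend : ∀ U v → IsΓDiagram S⁻ U → (v ≡ false → HookZero U) → IsΓDiagram S (setCorner U v)
  Γ-extend U v (d , no1110 , no0110) zero = diagram-extend U v d , extend no1110 , extend no0110
    where
    entry = from-setCorner U v
    extend : ∀ {a} → Avoids S⁻ U a true true false → Avoids S (setCorner U v) a true true false
    extend avoid (i , i' , j , j' , i<i' , j<j' , s₁ , s₂ , s₃ , s₄ , v₁ , v₂ , v₃ , v₄) with corner? i' j'
    ... | yes (refl , refl) = hit (zero (trans (sym (setCorner-corner U v)) v₄))
      where
      off₂ = off-row {j = j'} (row-above-corner i<i' s₄)
      off₃ = col-left-of-corner j<j' s₄
      hit : ¬ HookZero U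
      hit (inj₁ arm0) = clash (entry off₃ v₃) (arm0 j (to-S⁻ s₃ off₃))
      hit (inj₂ leg0) = clash (entry off₂ v₂) (leg0 i (to-S⁻ s₂ off₂))
    ... | no off₄ = avoid (i , i' , j , j' , i<i' , j<j' , to-S⁻ s₁ off₁ , to-S⁻ s₂ off₂ , to-S⁻ s₃ off₃ , to-S⁻ s₄ off₄ ,
                           entry off₁ v₁ , entry off₂ v₂ , entry off₃ v₃ , entry off₄ v₄)
      where
      off₁ = off-row {j = j} (row-above-corner i<i' s₃)
      off₂ = off-row {j = j'} (row-above-corner i<i' s₄)
      off₃ = col-left-of-corner j<j' s₄

  Γ-restrict : ∀ U → IsΓDiagram S U → IsΓDiagram S⁻ (setCorner U false)
  Γ-restrict U (d , no1110 , no0110) = diagram-restrict U d , shrink no1110 , shrink no0110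
    where
    entry = from-setCorner-S⁻ U false
    shrink : ∀ {a b d e} → Avoids S U a b d e → Avoids S⁻ (setCorner U false) a b d e
    shrink avoid (i , i' , j , j' , i<i' , j<j' , s₁ , s₂ , s₃ , s₄ , v₁ , v₂ , v₃ , v₄) =
      avoid (i , i' , j , j' , i<i' , j<j' , S⁻⊆S i j s₁ , S⁻⊆S i j' s₂ , S⁻⊆S i' j s₃ , S⁻⊆S i' j' s₄ ,
             entry s₁ v₁ , entry s₂ v₂ , entry s₃ v₃ , entry s₄ v₄)

  hook-pattern : ∀ U {i k b} → Leg i → Arm k → U [ i , k ] ≡ b → U [ i , c ] ≡ true → U [ r , k ] ≡ true →
    U [ r , c ] ≡ false → Contains S U b true true false
  hook-pattern U si sk t ti tk u₀ =
    _ , r , _ , c , leg-above si , arm-left sk , S⁻⊆S _ _ (hook-fill si sk) , S⁻⊆S _ c si , S⁻⊆S r _ sk , corner∈S ,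
    t , ti , tk , u₀

  Γ-corner0⇒hookZero : ∀ U → IsΓDiagram S U → U [ r , c ] ≡ false → HookZero (setCorner U false)
  Γ-corner0⇒hookZero U (d , no1110 , no0110) u₀ with armZero⊎hit U₀ | legZero⊎hit U₀
    where U₀ = setCorner U false
  ... | inj₁ arm0 | _           = inj₁ arm0
  ... | inj₂ _    | inj₁ leg0   = inj₂ leg0
  ... | inj₂ (k , sk , tk) | inj₂ (i , si , ti) with bool-cases (U [ i , k ])
  ...   | inj₁ t = ⊥-elim (no1110 (hook-pattern U si sk t (from-setCorner-S⁻ U false si ti) (from-setCorner-S⁻ U false sk tk) u₀))
  ...   | inj₂ t = ⊥-elim (no0110 (hook-pattern U si sk t (from-setCorner-S⁻ U false si ti) (from-setCorner-S⁻ U false sk tk) u₀))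

  -- Restricting to S⁻ keeps an X-diagram; conversely an
  -- S⁻-X-diagram T extends by corner value v exactly when Ext_v T holds,
  -- since every new rectangle has the corner as a vertex and, by
  -- Γ-completeness, its opposite vertex in the hook.
  crossingFree-restrict : ∀ M v → CrossingFree S M → CrossingFree S⁻ (setCorner M v)
  crossingFree-restrict M v free a a' x y (s₁ , s₂ , s₃ , s₄ , v₁ , v₂ , v₃ , v₄) =
    free a a' x y (S⁻⊆S _ _ s₁ , S⁻⊆S _ _ s₂ , S⁻⊆S _ _ s₃ , S⁻⊆S _ _ s₄ ,
                   entry s₁ v₁ , entry s₂ v₂ , entry s₃ v₃ , entry s₄ v₄)
    where entry = from-setCorner-S⁻ M v

  module _ (T : Matrix m n) (v : Bool) (free : CrossingFree S⁻ T)
           (ext1 : v ≡ true → Ext1 T) (ext0 : v ≡ false → Ext0 T) where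

    private
      entry = from-setCorner T v

    no-crossing-in-row-r : ∀ a' x y → a' ≢ r → ¬ Crossing S (setCorner T v) r a' x y
    no-crossing-in-row-r a' x y a'≢r (s₁ , s₂ , s₃ , s₄ , v₁ , v₂ , v₃ , v₄) with x F.≟ c | y F.≟ c
    ... | yes refl | yes refl = clash v₁ v₂
    ... | yes refl | no y≢c   =
      clash (ext1 (trans (sym (setCorner-corner T v)) v₁) a' y (to-S⁻ s₃ off) (to-S⁻ s₂ (off-col y≢c)) (entry off v₄) (entry off v₃))
            (entry (off-col y≢c) v₂)
      where off : ∀ {j} → ¬ IsCorner a' j
            off = off-row a'≢r
    ... | no x≢c   | yes refl =
      clash (ext0 (trans (sym (setCorner-corner T v)) v₂) a' x (to-S⁻ s₄ off) (to-S⁻ s₁ (off-col x≢c)) (entry off v₄) (entry (off-col x≢c) v₁))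
            (entry off v₃)
      where off : ∀ {j} → ¬ IsCorner a' j
            off = off-row a'≢r
    ... | no x≢c   | no y≢c   =
      free r a' x y (to-S⁻ s₁ (off-col x≢c) , to-S⁻ s₂ (off-col y≢c) , to-S⁻ s₃ off , to-S⁻ s₄ off ,
                     entry (off-col x≢c) v₁ , entry (off-col y≢c) v₂ , entry off v₃ , entry off v₄)
      where off : ∀ {j} → ¬ IsCorner a' j
            off = off-row a'≢r

    crossingFree-extend : CrossingFree S (setCorner T v)
    crossingFree-extend a a' x y cross@(s₁ , s₂ , s₃ , s₄ , v₁ , v₂ , v₃ , v₄) with a F.≟ r | a' F.≟ r
    ... | yes refl | yes refl = clash v₁ v₃
    ... | yes refl | no a'≢r  = no-crossing-in-row-r a' x y a'≢r cross
    ... | no a≢r   | yes refl = no-crossing-in-row-r a y x a≢r (s₄ , s₃ , s₂ , s₁ , v₄ , v₃ , v₂ , v₁)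
    ... | no a≢r   | no a'≢r  =
      free a a' x y (to-S⁻ s₁ (off-row a≢r) , to-S⁻ s₂ (off-row a≢r) , to-S⁻ s₃ (off-row a'≢r) , to-S⁻ s₄ (off-row a'≢r) ,
                     entry (off-row a≢r) v₁ , entry (off-row a≢r) v₂ , entry (off-row a'≢r) v₃ , entry (off-row a'≢r) v₄)

  corner1⇒ext1 : ∀ M → CrossingFree S M → M [ r , c ] ≡ true → Ext1 (setCorner M false)
  corner1⇒ext1 M free m₁ i k si sk t₁ t₂ with bool-cases (setCorner M false [ r , k ])
  ... | inj₁ t = t
  ... | inj₂ t = ⊥-elim (free i r k c (S⁻⊆S _ _ (hook-fill si sk) , S⁻⊆S _ _ si , S⁻⊆S _ _ sk , corner∈S ,
                                      entry (hook-fill si sk) t₁ , entry si t₂ , entry sk t , m₁))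
    where entry = from-setCorner-S⁻ M false

  corner0⇒ext0 : ∀ M → CrossingFree S M → M [ r , c ] ≡ false → Ext0 (setCorner M false)
  corner0⇒ext0 M free m₀ i k si sk t₁ t₂ with bool-cases (setCorner M false [ i , k ])
  ... | inj₁ t = t
  ... | inj₂ t = ⊥-elim (free r i k c (S⁻⊆S _ _ sk , corner∈S , S⁻⊆S _ _ (hook-fill si sk) , S⁻⊆S _ _ si ,
                                      entry sk t₂ , m₀ , entry (hook-fill si sk) t , entry si t₁))
    where entry = from-setCorner-S⁻ M false

  -- Corner value 0 is allowed whenever the hook is zero or value 1 is obstructed.
  hookZero⇒ext0 : ∀ T → HookZero T → Ext0 T
  hookZero⇒ext0 T (inj₁ arm0) i k si sk ti tk = ⊥-elim (clash tk (arm0 k sk))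
  hookZero⇒ext0 T (inj₂ leg0) i k si sk ti tk = ⊥-elim (clash ti (leg0 i si))

  -- For the latter, an obstruction (i , k) and a violation of Ext0 at
  -- (i' , k') produce a crossing whatever T is at (i , k') and (i' , k).
  obstr1⇒ext0 : ∀ T → CrossingFree S⁻ T → Obstr1 T → Ext0 T
  obstr1⇒ext0 T free (i , k , si , sk , t₁ , t₂ , t₃) i' k' si' sk' u₁ u₂ with bool-cases (T [ i' , k' ])
  ... | inj₁ e = e
  ... | inj₂ e with bool-cases (T [ i , k' ])
  ...   | inj₂ f = ⊥-elim (free i r k k' (hook-fill si sk , hook-fill si sk' , sk , sk' , t₁ , f , t₃ , u₂))
  ...   | inj₁ f with bool-cases (T [ i' , k ])
  ...     | inj₁ g = ⊥-elim (free i' r k k' (hook-fill si' sk , hook-fill si' sk' , sk , sk' , g , e , t₃ , u₂))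
  ...     | inj₂ g = ⊥-elim (free i i' k c (hook-fill si sk , si , hook-fill si' sk , si' , t₁ , t₂ , g , u₁))

  LegCell ArmCell : Fin m → Fin n → Set
  LegCell i j = j ≡ c × S⁻ [ i , j ] ≡ true
  ArmCell i j = i ≡ r × S⁻ [ i , j ] ≡ true

  legCell? : ∀ i j → Dec (LegCell i j)
  legCell? i j = (j F.≟ c) ×-dec (S⁻ [ i , j ] ≟ᵇ true)

  armCell? : ∀ i j → Dec (ArmCell i j)
  armCell? i j = (i F.≟ r) ×-dec (S⁻ [ i , j ] ≟ᵇ true)

  setLeg : (Fin m → Bool) → Matrix m n → Matrix m n
  setLeg f = overwrite legCell? (λ i _ → f i)

  setArm : (Fin n → Bool) → Matrix m n → Matrix m n
  setArm f = overwrite armCell? (λ _ j → f j)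

  setLeg-leg : ∀ f T {i} → Leg i → setLeg f T [ i , c ] ≡ f i
  setLeg-leg f T si = overwrite-inside legCell? _ T (refl , si)

  setLeg-off : ∀ f T {i j} → ¬ LegCell i j → setLeg f T [ i , j ] ≡ T [ i , j ]
  setLeg-off f T = overwrite-outside legCell? _ T

  setLeg-col≢c : ∀ f T {i j} → j ≢ c → setLeg f T [ i , j ] ≡ T [ i , j ]
  setLeg-col≢c f T j≢c = setLeg-off f T (j≢c ∘ proj₁)

  setLeg-row-r : ∀ f T {j} → setLeg f T [ r , j ] ≡ T [ r , j ]
  setLeg-row-r f T = setLeg-off f T λ { (refl , s) → clash s corner∉S⁻ }

  setArm-arm : ∀ f T {k} → Arm k → setArm f T [ r , k ] ≡ f k
  setArm-arm f T sk = overwrite-inside armCell? _ T (refl , sk)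

  setArm-off : ∀ f T {i j} → ¬ ArmCell i j → setArm f T [ i , j ] ≡ T [ i , j ]
  setArm-off f T = overwrite-outside armCell? _ T

  setArm-row≢r : ∀ f T {i j} → i ≢ r → setArm f T [ i , j ] ≡ T [ i , j ]
  setArm-row≢r f T i≢r = setArm-off f T (i≢r ∘ proj₁)

  setArm-col-c : ∀ f T {i} → setArm f T [ i , c ] ≡ T [ i , c ]
  setArm-col-c f T = setArm-off f T λ { (refl , s) → clash s corner∉S⁻ }

  setLeg-diagram : ∀ f T → IsDiagram S⁻ T → IsDiagram S⁻ (setLeg f T)
  setLeg-diagram f T d i j s = trans (setLeg-off f T (λ cell → clash (proj₂ cell) s)) (d i j s)

  setArm-diagram : ∀ f T → IsDiagram S⁻ T → IsDiagram S⁻ (setArm f T)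
  setArm-diagram f T d i j s = trans (setArm-off f T (λ cell → clash (proj₂ cell) s)) (d i j s)

  hook-ext : ∀ {A B : Matrix m n} → (∀ k → Arm k → A [ r , k ] ≡ B [ r , k ]) → (∀ i → Leg i → A [ i , c ] ≡ B [ i , c ]) →
    (∀ {i j} → ¬ ArmCell i j → ¬ LegCell i j → A [ i , j ] ≡ B [ i , j ]) → A ≡ B
  hook-ext {A} {B} arm leg rest = matrix-ext cell
    where
    cell : ∀ i j → A [ i , j ] ≡ B [ i , j ]
    cell i j with i F.≟ r | j F.≟ c | bool-cases (S⁻ [ i , j ])
    ... | yes refl | _        | inj₁ s = arm j s
    ... | no i≢r   | yes refl | inj₁ s = leg i s
    ... | no i≢r   | no j≢c   | inj₁ _ = rest (i≢r ∘ proj₁) (j≢c ∘ proj₁)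
    ... | _        | _        | inj₂ s = rest (λ cell → clash (proj₂ cell) s) (λ cell → clash (proj₂ cell) s)

  from-setLeg : ∀ f T {i j b} → j ≢ c → setLeg f T [ i , j ] ≡ b → T [ i , j ] ≡ b
  from-setLeg f T j≢c = trans (sym (setLeg-col≢c f T j≢c))

  from-setArm : ∀ f T {i j b} → i ≢ r → setArm f T [ i , j ] ≡ b → T [ i , j ] ≡ b
  from-setArm f T i≢r = trans (sym (setArm-row≢r f T i≢r))

  module _ (f : Fin m → Bool) (T : Matrix m n) (free : CrossingFree S⁻ T)
    (separated : ∀ i → Leg i → f i ≡ true →
       Σ[ k ∈ Fin n ] (Arm k × T [ i , k ] ≡ true × (∀ i' → Leg i' → f i' ≡ false → T [ i' , k ] ≡ false))) where

    no-crossing-through-leg : ∀ a a' y → y ≢ c → ¬ Crossing S⁻ (setLeg f T) a a' c y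
    no-crossing-through-leg a a' y y≢c (s₁ , s₂ , s₃ , s₄ , v₁ , v₂ , v₃ , v₄)
      with separated a s₁ (trans (sym (setLeg-leg f T s₁)) v₁)
    ... | k , sk , tk , zeros =
      free a a' k y (hook-fill s₁ sk , s₂ , hook-fill s₃ sk , s₄ , tk , from-setLeg f T y≢c v₂ ,
                     zeros a' s₃ (trans (sym (setLeg-leg f T s₃)) v₃) , from-setLeg f T y≢c v₄)

    setLeg-crossingFree : CrossingFree S⁻ (setLeg f T)
    setLeg-crossingFree a a' x y cross@(s₁ , s₂ , s₃ , s₄ , v₁ , v₂ , v₃ , v₄) with x F.≟ c | y F.≟ c
    ... | yes refl | yes refl = clash v₁ v₂
    ... | yes refl | no y≢c   = no-crossing-through-leg a a' y y≢c cross
    ... | no x≢c   | yes refl = no-crossing-through-leg a' a x x≢c (s₄ , s₃ , s₂ , s₁ , v₄ , v₃ , v₂ , v₁)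
    ... | no x≢c   | no y≢c   =
      free a a' x y (s₁ , s₂ , s₃ , s₄ , from-setLeg f T x≢c v₁ , from-setLeg f T y≢c v₂ , from-setLeg f T x≢c v₃ , from-setLeg f T y≢c v₄)

  module _ (f : Fin n → Bool) (T : Matrix m n) (free : CrossingFree S⁻ T)
    (separated : ∀ x y → Arm x → Arm y → f x ≡ true → f y ≡ false →
       Σ[ i ∈ Fin m ] (Leg i × T [ i , x ] ≡ true × T [ i , y ] ≡ false)) where

    no-crossing-through-arm : ∀ a' x y → a' ≢ r → ¬ Crossing S⁻ (setArm f T) r a' x y
    no-crossing-through-arm a' x y a'≢r (s₁ , s₂ , s₃ , s₄ , v₁ , v₂ , v₃ , v₄)
      with separated x y s₁ s₂ (trans (sym (setArm-arm f T s₁)) v₁) (trans (sym (setArm-arm f T s₂)) v₂)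
    ... | i , si , ti₁ , ti₀ =
      free i a' x y (hook-fill si s₁ , hook-fill si s₂ , s₃ , s₄ , ti₁ , ti₀ , from-setArm f T a'≢r v₃ , from-setArm f T a'≢r v₄)

    setArm-crossingFree : CrossingFree S⁻ (setArm f T)
    setArm-crossingFree a a' x y cross@(s₁ , s₂ , s₃ , s₄ , v₁ , v₂ , v₃ , v₄) with a F.≟ r | a' F.≟ r
    ... | yes refl | yes refl = clash v₁ v₃
    ... | yes refl | no a'≢r  = no-crossing-through-arm a' x y a'≢r cross
    ... | no a≢r   | yes refl = no-crossing-through-arm a y x a≢r (s₄ , s₃ , s₂ , s₁ , v₄ , v₃ , v₂ , v₁)
    ... | no a≢r   | no a'≢r  =
      free a a' x y (s₁ , s₂ , s₃ , s₄ , from-setArm f T a≢r v₁ , from-setArm f T a≢r v₂ , from-setArm f T a'≢r v₃ , from-setArm f T a'≢r v₄)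

  Dominated RowMeetsArm : Matrix m n → Fin m → Set
  Dominated T i   = ∀ k → Arm k → T [ i , k ] ≡ true → T [ r , k ] ≡ true
  RowMeetsArm T i = Σ[ k ∈ Fin n ] (Arm k × T [ i , k ] ≡ true)

  Undominated : Matrix m n → Fin m → Set
  Undominated T i = Σ[ k ∈ Fin n ] (Arm k × T [ i , k ] ≡ true × T [ r , k ] ≡ false)

  AllOnes : Matrix m n → (Fin m → Bool) → Fin n → Set
  AllOnes T J k = ∀ i → Leg i → J i ≡ true → T [ i , k ] ≡ true

  NotAllOnes : Matrix m n → (Fin m → Bool) → Fin n → Set
  NotAllOnes T J k = Σ[ i ∈ Fin m ] (Leg i × J i ≡ true × T [ i , k ] ≡ false)

  dominated⊎not : ∀ T i → Dominated T i ⊎ Undominated T i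
  dominated⊎not T i = all-or-witness n λ k → clause₃ (S⁻ [ r , k ]) (T [ i , k ]) (T [ r , k ])

  undominated⇒¬dominated : ∀ T i → Undominated T i → ¬ Dominated T i
  undominated⇒¬dominated T i (k , sk , t , f) dom = clash (dom k sk t) f

  ¬dominated⇒undominated : ∀ T i → ¬ Dominated T i → Undominated T i
  ¬dominated⇒undominated T i ¬dom with dominated⊎not T i
  ... | inj₁ dom   = ⊥-elim (¬dom dom)
  ... | inj₂ undom = undom

  dominated? : ∀ T i → Dec (Dominated T i)
  dominated? T i with dominated⊎not T i
  ... | inj₁ dom   = yes dom
  ... | inj₂ undom = no (undominated⇒¬dominated T i undom)

  rowMeetsArm? : ∀ T i → Dec (RowMeetsArm T i)
  rowMeetsArm? T i = FP.any? λ k → (S⁻ [ r , k ] ≟ᵇ true) ×-dec (T [ i , k ] ≟ᵇ true)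

  allOnes⊎not : ∀ T J k → AllOnes T J k ⊎ NotAllOnes T J k
  allOnes⊎not T J k = all-or-witness m λ i → clause₃ (S⁻ [ i , c ]) (J i) (T [ i , k ])

  allOnes? : ∀ T J k → Dec (AllOnes T J k)
  allOnes? T J k with allOnes⊎not T J k
  ... | inj₁ ones               = yes ones
  ... | inj₂ (i , si , ji , tf) = no λ ones → clash (ones i si ji) tf

  notAllOnes : ∀ T J k → ¬ AllOnes T J k → NotAllOnes T J k
  notAllOnes T J k ¬ones with allOnes⊎not T J k
  ... | inj₁ ones = ⊥-elim (¬ones ones)
  ... | inj₂ w    = w

  ArmSupport⊆ : Matrix m n → Fin m → Fin m → Set
  ArmSupport⊆ T x y = ∀ k → Arm k → T [ x , k ] ≡ true → T [ y , k ] ≡ true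

  leg-rows-nested : ∀ T → CrossingFree S⁻ T → ∀ {x y} → Leg x → Leg y → ArmSupport⊆ T x y ⊎ ArmSupport⊆ T y x
  leg-rows-nested T free {x} {y} sx sy with all-or-witness n (λ k → clause₃ (S⁻ [ r , k ]) (T [ x , k ]) (T [ y , k ]))
  ... | inj₁ x⊆y                 = inj₁ x⊆y
  ... | inj₂ (k , sk , tx , ¬ty) = inj₂ y⊆x
    where
    y⊆x : ArmSupport⊆ T y x
    y⊆x k' sk' ty' with bool-cases (T [ x , k' ])
    ... | inj₁ tx' = tx'
    ... | inj₂ ¬tx' = ⊥-elim (free x y k k' (hook-fill sx sk , hook-fill sx sk' , hook-fill sy sk , hook-fill sy sk' , tx , ¬tx' , ¬ty , ty'))

  least-leg-row : ∀ T → CrossingFree S⁻ T → (J : Fin m → Bool) → Σ[ i ∈ Fin m ] (Leg i × J i ≡ true) →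
    Σ[ i* ∈ Fin m ] ((Leg i* × J i* ≡ true) × (∀ i → Leg i × J i ≡ true → ArmSupport⊆ T i* i))
  least-leg-row T free J = least m (λ i → Leg i × J i ≡ true) (λ i → (S⁻ [ i , c ] ≟ᵇ true) ×-dec (J i ≟ᵇ true))
    (ArmSupport⊆ T) (λ x⊆y y⊆z k sk → y⊆z k sk ∘ x⊆y k sk) (λ x y jx jy → leg-rows-nested T free (proj₁ jx) (proj₁ jy))

  undominated? : ∀ T i → Dec (Undominated T i)
  undominated? T i = FP.any? λ k → (S⁻ [ r , k ] ≟ᵇ true) ×-dec (T [ i , k ] ≟ᵇ true) ×-dec (T [ r , k ] ≟ᵇ false)

  -- The two classes of S⁻-X-diagrams that must be matched: Blocked ones
  -- have a zero arm or leg yet cannot take corner 1; Free ones have nonzero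
  -- arm and leg and can take either corner value.
  Blocked Free : Matrix m n → Set
  Blocked T = XDiagram S⁻ T × HookZero T × Obstr1 T
  Free T    = XDiagram S⁻ T × ArmHit T × LegHit T × Ext1 T × Ext0 T

  free⇒¬hookZero : ∀ T → Free T → ¬ HookZero T
  free⇒¬hookZero T (_ , armHit , _) (inj₁ arm0)      = armHit⇒¬zero T armHit arm0
  free⇒¬hookZero T (_ , _ , legHit , _) (inj₂ leg0) = legHit⇒¬zero T legHit leg0

  -- unblock : Blocked → Free fills the zero part of the hook.
  legValue meetsArm undominatedRow : Matrix m n → Fin m → Bool
  legValue T i       = T [ i , c ]
  meetsArm T i       = does (rowMeetsArm? T i)
  undominatedRow T i = does (undominated? T i)

  onesUnder : Matrix m n → (Fin m → Bool) → Fin n → Bool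
  onesUnder T J k = does (allOnes? T J k)

  fillLeg fillArm fillHook : Matrix m n → Matrix m n
  fillLeg T  = setLeg (undominatedRow T) T
  fillArm T  = setArm (onesUnder T (legValue T)) T
  fillHook T = setArm (onesUnder T (meetsArm T)) (setLeg (meetsArm T) T)

  unblock-by : ∀ T → Dec (LegZero T) → Dec (ArmZero T) → Matrix m n
  unblock-by T (yes _) (no _)  = fillLeg T
  unblock-by T (yes _) (yes _) = fillHook T
  unblock-by T (no _)  _       = fillArm T

  unblock : Matrix m n → Matrix m n
  unblock T = unblock-by T (legZero? T) (armZero? T)

  -- block : Free → Blocked clears the leg, the arm, or both, according to
  -- whether some leg 1 sits in a dominated row and some leg 0 in a row
  -- meeting the arm.
  DominatedLegOne MeetingLegZero : Matrix m n → Set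
  DominatedLegOne T = Σ[ i ∈ Fin m ] (Leg i × T [ i , c ] ≡ true × Dominated T i)
  MeetingLegZero T  = Σ[ i ∈ Fin m ] (Leg i × T [ i , c ] ≡ false × RowMeetsArm T i)

  dominatedLegOne? : ∀ T → Dec (DominatedLegOne T)
  dominatedLegOne? T = FP.any? λ i → (S⁻ [ i , c ] ≟ᵇ true) ×-dec (T [ i , c ] ≟ᵇ true) ×-dec dominated? T i

  meetingLegZero? : ∀ T → Dec (MeetingLegZero T)
  meetingLegZero? T = FP.any? λ i → (S⁻ [ i , c ] ≟ᵇ true) ×-dec (T [ i , c ] ≟ᵇ false) ×-dec rowMeetsArm? T i

  clearLeg clearArm clearHook : Matrix m n → Matrix m n
  clearLeg T  = setLeg (λ _ → false) T
  clearArm T  = setArm (λ _ → false) T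
  clearHook T = clearArm (clearLeg T)

  block-by : ∀ T → Dec (DominatedLegOne T) → Dec (MeetingLegZero T) → Matrix m n
  block-by T (no _)  _       = clearLeg T
  block-by T (yes _) (yes _) = clearArm T
  block-by T (yes _) (no _)  = clearHook T

  block : Matrix m n → Matrix m n
  block T = block-by T (dominatedLegOne? T) (meetingLegZero? T)

  ¬undominated⇒dominated : ∀ T i → ¬ Undominated T i → Dominated T i
  ¬undominated⇒dominated T i ¬und k sk t with bool-cases (T [ r , k ])
  ... | inj₁ tr = tr
  ... | inj₂ tr = ⊥-elim (¬und (k , sk , t , tr))

  meetsArm-separated : ∀ T i → Leg i → meetsArm T i ≡ true →
    Σ[ k ∈ Fin n ] (Arm k × T [ i , k ] ≡ true × (∀ i' → Leg i' → meetsArm T i' ≡ false → T [ i' , k ] ≡ false))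
  meetsArm-separated T i si mi with does-true (rowMeetsArm? T i) mi
  ... | k , sk , tk = k , sk , tk , λ i' si' mi' → zero-at i' (does-false (rowMeetsArm? T i') mi')
    where
    zero-at : ∀ i' → ¬ RowMeetsArm T i' → T [ i' , k ] ≡ false
    zero-at i' ¬meets with bool-cases (T [ i' , k ])
    ... | inj₁ t = ⊥-elim (¬meets (k , sk , t))
    ... | inj₂ t = t

  -- A filled arm is separated by leg rows: a column with value 1 is all
  -- ones on the selected leg rows, a column with value 0 is not.
  onesUnder-separated : ∀ T J x y → Arm x → Arm y → onesUnder T J x ≡ true → onesUnder T J y ≡ false →
    Σ[ i ∈ Fin m ] (Leg i × T [ i , x ] ≡ true × T [ i , y ] ≡ false)
  onesUnder-separated T J x y sx sy ox oy with notAllOnes T J y (does-false (allOnes? T J y) oy)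
  ... | i , si , ji , ti = i , si , does-true (allOnes? T J x) ox i si ji , ti

  fillLeg-free : ∀ T → Blocked T → LegZero T → ArmHit T → Free (fillLeg T)
  fillLeg-free T ((d , free) , _ , (i₀ , k₀ , si₀ , sk₀ , t₁ , _ , t₃)) _ (kr , skr , tkr) =
    (setLeg-diagram f T d , setLeg-crossingFree f T free separated) ,
    (kr , skr , trans (setLeg-row-r f T) tkr) ,
    (i₀ , si₀ , trans (setLeg-leg f T si₀) (dec-true (undominated? T i₀) (k₀ , sk₀ , t₁ , t₃))) ,
    ext1 , ext0
    where
    f = undominatedRow T
    entry : ∀ {i j b} → j ≢ c → fillLeg T [ i , j ] ≡ b → T [ i , j ] ≡ b
    entry = from-setLeg f T
    leg : ∀ {i b} → Leg i → fillLeg T [ i , c ] ≡ b → f i ≡ b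
    leg si = trans (sym (setLeg-leg f T si))
    -- An undominated row has an arm column where row r, hence every dominated row, is 0.
    separated : ∀ i → Leg i → f i ≡ true →
      Σ[ k ∈ Fin n ] (Arm k × T [ i , k ] ≡ true × (∀ i' → Leg i' → f i' ≡ false → T [ i' , k ] ≡ false))
    separated i si fi with does-true (undominated? T i) fi
    ... | k , sk , tk , tr = k , sk , tk , λ i' si' fi' → zero-at i' (does-false (undominated? T i') fi')
      where
      zero-at : ∀ i' → ¬ Undominated T i' → T [ i' , k ] ≡ false
      zero-at i' ¬und with bool-cases (T [ i' , k ])
      ... | inj₁ t = ⊥-elim (¬und (k , sk , t , tr))
      ... | inj₂ t = t
    ext1 : Ext1 (fillLeg T)
    ext1 i k si sk e₁ e₂ = trans (setLeg-row-r f T)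
      (¬undominated⇒dominated T i (does-false (undominated? T i) (leg si e₂)) k sk (entry (arm≢c sk) e₁))
    -- A new leg 1 in row i comes with an arm column k₁ where row i is 1 and
    -- row r is 0; a 0 at (i , k) below a 1 of row r would cross it.
    ext0 : Ext0 (fillLeg T)
    ext0 i k si sk e₁ e₂ with does-true (undominated? T i) (leg si e₁) | bool-cases (T [ i , k ])
    ... | _ | inj₁ t = trans (setLeg-col≢c f T (arm≢c sk)) t
    ... | k₁ , sk₁ , tk₁ , tr₁ | inj₂ t =
      ⊥-elim (free i r k₁ k (hook-fill si sk₁ , hook-fill si sk , sk₁ , sk , tk₁ , t , tr₁ , trans (sym (setLeg-row-r f T)) e₂))

  fillArm-free : ∀ T → Blocked T → ArmZero T → LegHit T → Free (fillArm T)
  fillArm-free T ((d , free) , _ , (i₀ , k₀ , si₀ , sk₀ , t₁ , t₂ , _)) _ (ic , sic , tic) =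
    (setArm-diagram f T d , setArm-crossingFree f T free (onesUnder-separated T (legValue T))) ,
    (k₀ , sk₀ , trans (setArm-arm f T sk₀) (dec-true (allOnes? T (legValue T) k₀) ones-k₀)) ,
    (ic , sic , trans (setArm-col-c f T) tic) ,
    ext1 , ext0
    where
    f = onesUnder T (legValue T)
    -- The obstruction column k₀ is 1 on every leg-one row, else a crossing.
    ones-k₀ : AllOnes T (legValue T) k₀
    ones-k₀ i si ti with bool-cases (T [ i , k₀ ])
    ... | inj₁ t = t
    ... | inj₂ t = ⊥-elim (free i₀ i k₀ c (hook-fill si₀ sk₀ , si₀ , hook-fill si sk₀ , si , t₁ , t₂ , t , ti))
    ext1 : Ext1 (fillArm T)
    ext1 i k si sk e₁ e₂ = trans (setArm-arm f T sk) (dec-true (allOnes? T (legValue T) k) ones)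
      where
      ones : AllOnes T (legValue T) k
      ones i' si' ti' with bool-cases (T [ i' , k ])
      ... | inj₁ t = t
      ... | inj₂ t = ⊥-elim (free i i' k c (hook-fill si sk , si , hook-fill si' sk , si' ,
                       from-setArm f T (leg≢r si) e₁ , trans (sym (setArm-col-c f T)) e₂ , t , ti'))
    ext0 : Ext0 (fillArm T)
    ext0 i k si sk e₁ e₂ = trans (setArm-row≢r f T (leg≢r si))
      (does-true (allOnes? T (legValue T) k) (trans (sym (setArm-arm f T sk)) e₂) i si (trans (sym (setArm-col-c f T)) e₁))

  fillHook-inner : ∀ T {i k} → Leg i → Arm k → fillHook T [ i , k ] ≡ T [ i , k ]
  fillHook-inner T si sk = trans (setArm-row≢r (onesUnder T (meetsArm T)) (setLeg (meetsArm T) T) (leg≢r si)) (setLeg-col≢c (meetsArm T) T (arm≢c sk))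

  fillHook-leg : ∀ T {i} → Leg i → fillHook T [ i , c ] ≡ meetsArm T i
  fillHook-leg T si = trans (setArm-col-c (onesUnder T (meetsArm T)) (setLeg (meetsArm T) T)) (setLeg-leg (meetsArm T) T si)

  fillHook-free : ∀ T → Blocked T → ArmZero T → LegZero T → Free (fillHook T)
  fillHook-free T ((d , free) , _ , (i₀ , k₀ , si₀ , sk₀ , t₁ , _ , _)) _ _ =
    (setArm-diagram f T₁ (setLeg-diagram g T d) ,
     setArm-crossingFree f T₁ (setLeg-crossingFree g T free (meetsArm-separated T)) separated) ,
    arm-hit ,
    (i₀ , si₀ , trans (setArm-col-c f T₁) (trans (setLeg-leg g T si₀) (dec-true (rowMeetsArm? T i₀) (k₀ , sk₀ , t₁)))) ,
    ext1 , ext0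
    where
    g  = meetsArm T
    T₁ = setLeg g T
    f  = onesUnder T g
    inner = fillHook-inner T
    leg   = fillHook-leg T
    separated : ∀ x y → Arm x → Arm y → f x ≡ true → f y ≡ false → Σ[ i ∈ Fin m ] (Leg i × T₁ [ i , x ] ≡ true × T₁ [ i , y ] ≡ false)
    separated x y sx sy fx fy with onesUnder-separated T g x y sx sy fx fy
    ... | i , si , tx , ty = i , si , trans (setLeg-col≢c g T (arm≢c sx)) tx , trans (setLeg-col≢c g T (arm≢c sy)) ty
    -- The least row meeting the arm puts a 1 into the new arm.
    arm-hit : ArmHit (fillHook T)
    arm-hit with least-leg-row T free g (i₀ , si₀ , dec-true (rowMeetsArm? T i₀) (k₀ , sk₀ , t₁))
    ... | i* , (si* , gi*) , least-support with does-true (rowMeetsArm? T i*) gi*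
    ...   | k* , sk* , tk* = k* , sk* , trans (setArm-arm f T₁ sk*)
                                  (dec-true (allOnes? T g k*) (λ i si gi → least-support i (si , gi) k* sk* tk*))
    ext1 : Ext1 (fillHook T)
    ext1 i k si sk e₁ e₂ =
      ⊥-elim (clash (dec-true (rowMeetsArm? T i) (k , sk , trans (sym (inner si sk)) e₁)) (trans (sym (leg si)) e₂))
    ext0 : Ext0 (fillHook T)
    ext0 i k si sk e₁ e₂ = trans (inner si sk)
      (does-true (allOnes? T g k) (trans (sym (setArm-arm f T₁ sk)) e₂) i si (trans (sym (leg si)) e₁))

  unblock-free : ∀ T → Blocked T → Free (unblock T)
  unblock-free T = by-cases (legZero? T) (armZero? T)
    where
    by-cases : ∀ dLeg dArm → Blocked T → Free (unblock-by T dLeg dArm)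
    by-cases (yes leg0) (no ¬arm0) b = fillLeg-free T b leg0 (¬armZero⇒hit T ¬arm0)
    by-cases (yes leg0) (yes arm0) b = fillHook-free T b arm0 leg0
    by-cases (no ¬leg0) _ b@(_ , inj₁ arm0 , _) = fillArm-free T b arm0 (¬legZero⇒hit T ¬leg0)
    by-cases (no ¬leg0) _ (_ , inj₂ leg0 , _) = ⊥-elim (¬leg0 leg0)

  clearLeg-crossingFree : ∀ T → CrossingFree S⁻ T → CrossingFree S⁻ (clearLeg T)
  clearLeg-crossingFree T free = setLeg-crossingFree _ T free (λ _ _ ())

  clearArm-crossingFree : ∀ T → CrossingFree S⁻ T → CrossingFree S⁻ (clearArm T)
  clearArm-crossingFree T free = setArm-crossingFree _ T free (λ _ _ _ _ ())

  clearLeg-blocked : ∀ T → Free T → ¬ DominatedLegOne T → Blocked (clearLeg T)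
  clearLeg-blocked T ((d , free) , _ , (i₁ , si₁ , ti₁) , _) ¬dom
    with ¬dominated⇒undominated T i₁ (λ dom → ¬dom (i₁ , si₁ , ti₁ , dom))
  ... | k , sk , tk , tr =
    (setLeg-diagram _ T d , clearLeg-crossingFree T free) ,
    inj₂ (λ i si → setLeg-leg _ T si) ,
    (i₁ , k , si₁ , sk , trans (setLeg-col≢c _ T (arm≢c sk)) tk , setLeg-leg _ T si₁ , trans (setLeg-row-r _ T) tr)

  clearArm-blocked : ∀ T → Free T → MeetingLegZero T → Blocked (clearArm T)
  clearArm-blocked T ((d , free) , _) (i , si , ti , k , sk , tk) =
    (setArm-diagram _ T d , clearArm-crossingFree T free) ,
    inj₁ (λ k sk → setArm-arm _ T sk) ,
    (i , k , si , sk , trans (setArm-row≢r _ T (leg≢r si)) tk , trans (setArm-col-c _ T) ti , setArm-arm _ T sk)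

  clearHook-blocked : ∀ T → Free T → DominatedLegOne T → Blocked (clearHook T)
  clearHook-blocked T ((d , free) , (k , sk , tk) , _ , _ , ext0) (i , si , ti , _) =
    (setArm-diagram _ T₁ (setLeg-diagram _ T d) , clearArm-crossingFree T₁ (clearLeg-crossingFree T free)) ,
    inj₁ (λ k sk → setArm-arm _ T₁ sk) ,
    (i , k , si , sk , trans (setArm-row≢r _ T₁ (leg≢r si)) (trans (setLeg-col≢c _ T (arm≢c sk)) (ext0 i k si sk ti tk)) ,
     trans (setArm-col-c _ T₁) (setLeg-leg _ T si) , setArm-arm _ T₁ sk)
    where
    T₁ = clearLeg T

  block-blocked : ∀ T → Free T → Blocked (block T)
  block-blocked T = by-cases (dominatedLegOne? T) (meetingLegZero? T)
    where
    by-cases : ∀ dDom dMeet → Free T → Blocked (block-by T dDom dMeet)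
    by-cases (no ¬dom) _         f = clearLeg-blocked T f ¬dom
    by-cases (yes _)   (yes meet) f = clearArm-blocked T f meet
    by-cases (yes dom) (no _)    f = clearHook-blocked T f dom

  unblock-leg : ∀ T → LegZero T → ¬ ArmZero T → unblock T ≡ fillLeg T
  unblock-leg T leg0 ¬arm0 = by-cases (legZero? T) (armZero? T)
    where
    by-cases : ∀ dLeg dArm → unblock-by T dLeg dArm ≡ fillLeg T
    by-cases (yes _)     (no _)      = refl
    by-cases (yes _)     (yes arm0)  = ⊥-elim (¬arm0 arm0)
    by-cases (no ¬leg0)  _           = ⊥-elim (¬leg0 leg0)

  unblock-arm : ∀ T → ¬ LegZero T → unblock T ≡ fillArm T
  unblock-arm T ¬leg0 = by-cases (legZero? T) (armZero? T)
    where
    by-cases : ∀ dLeg dArm → unblock-by T dLeg dArm ≡ fillArm T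
    by-cases (yes leg0) _ = ⊥-elim (¬leg0 leg0)
    by-cases (no _)     _ = refl

  unblock-hook : ∀ T → LegZero T → ArmZero T → unblock T ≡ fillHook T
  unblock-hook T leg0 arm0 = by-cases (legZero? T) (armZero? T)
    where
    by-cases : ∀ dLeg dArm → unblock-by T dLeg dArm ≡ fillHook T
    by-cases (yes _)    (yes _)     = refl
    by-cases (yes _)    (no ¬arm0)  = ⊥-elim (¬arm0 arm0)
    by-cases (no ¬leg0) _           = ⊥-elim (¬leg0 leg0)

  block-leg : ∀ T → ¬ DominatedLegOne T → block T ≡ clearLeg T
  block-leg T ¬dom = by-cases (dominatedLegOne? T) (meetingLegZero? T)
    where
    by-cases : ∀ dDom dMeet → block-by T dDom dMeet ≡ clearLeg T
    by-cases (yes dom) _ = ⊥-elim (¬dom dom)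
    by-cases (no _)    _ = refl

  block-arm : ∀ T → DominatedLegOne T → MeetingLegZero T → block T ≡ clearArm T
  block-arm T dom meet = by-cases (dominatedLegOne? T) (meetingLegZero? T)
    where
    by-cases : ∀ dDom dMeet → block-by T dDom dMeet ≡ clearArm T
    by-cases (yes _)  (yes _)     = refl
    by-cases (yes _)  (no ¬meet)  = ⊥-elim (¬meet meet)
    by-cases (no ¬dom) _          = ⊥-elim (¬dom dom)

  block-hook : ∀ T → DominatedLegOne T → ¬ MeetingLegZero T → block T ≡ clearHook T
  block-hook T dom ¬meet = by-cases (dominatedLegOne? T) (meetingLegZero? T)
    where
    by-cases : ∀ dDom dMeet → block-by T dDom dMeet ≡ clearHook T
    by-cases (yes _)   (no _)     = refl
    by-cases (yes _)   (yes meet) = ⊥-elim (¬meet meet)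
    by-cases (no ¬dom) _          = ⊥-elim (¬dom dom)

  block-fillLeg : ∀ T → LegZero T → block (fillLeg T) ≡ T
  block-fillLeg T leg0 = trans (block-leg (fillLeg T) ¬dom) cleared
    where
    f = undominatedRow T
    ¬dom : ¬ DominatedLegOne (fillLeg T)
    ¬dom (i , si , fi , dom) with does-true (undominated? T i) (trans (sym (setLeg-leg f T si)) fi)
    ... | k , sk , tk , tr =
      clash (trans (sym (setLeg-row-r f T)) (dom k sk (trans (setLeg-col≢c f T (arm≢c sk)) tk))) tr
    cleared : clearLeg (fillLeg T) ≡ T
    cleared = hook-ext (λ k sk → trans (setLeg-row-r _ (fillLeg T)) (setLeg-row-r f T))
                       (λ i si → trans (setLeg-leg _ (fillLeg T) si) (sym (leg0 i si)))
                       (λ _ ¬leg → trans (setLeg-off _ (fillLeg T) ¬leg) (setLeg-off f T ¬leg))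

  block-fillArm : ∀ T → Blocked T → ArmZero T → ¬ LegZero T → block (fillArm T) ≡ T
  block-fillArm T ((d , free) , _ , (i₀ , k₀ , si₀ , sk₀ , t₁ , t₂ , _)) arm0 ¬leg0 =
    trans (block-arm (fillArm T) dom meet) cleared
    where
    f = onesUnder T (legValue T)
    -- The leg-one row of least arm support is dominated by the new arm.
    dom : DominatedLegOne (fillArm T)
    dom with least-leg-row T free (legValue T) (¬legZero⇒hit T ¬leg0)
    ... | i* , (si* , ti*) , least-support =
      i* , si* , trans (setArm-col-c f T) ti* ,
      λ k sk t → trans (setArm-arm f T sk)
        (dec-true (allOnes? T (legValue T) k) (λ i si ti → least-support i (si , ti) k sk (from-setArm f T (leg≢r si*) t)))
    meet : MeetingLegZero (fillArm T)
    meet = i₀ , si₀ , trans (setArm-col-c f T) t₂ , k₀ , sk₀ , trans (setArm-row≢r f T (leg≢r si₀)) t₁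
    cleared : clearArm (fillArm T) ≡ T
    cleared = hook-ext (λ k sk → trans (setArm-arm _ (fillArm T) sk) (sym (arm0 k sk)))
                       (λ i si → trans (setArm-col-c _ (fillArm T)) (setArm-col-c f T))
                       (λ ¬arm _ → trans (setArm-off _ (fillArm T) ¬arm) (setArm-off f T ¬arm))

  block-fillHook : ∀ T → Blocked T → ArmZero T → LegZero T → block (fillHook T) ≡ T
  block-fillHook T ((d , free) , _ , (i₀ , k₀ , si₀ , sk₀ , t₁ , _ , _)) arm0 leg0 =
    trans (block-hook (fillHook T) dom ¬meet) cleared
    where
    g  = meetsArm T
    T₁ = setLeg g T
    f  = onesUnder T g
    -- The row of least arm support among those meeting the arm is dominated.
    dom : DominatedLegOne (fillHook T)
    dom with least-leg-row T free g (i₀ , si₀ , dec-true (rowMeetsArm? T i₀) (k₀ , sk₀ , t₁))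
    ... | i* , (si* , gi*) , least-support =
      i* , si* , trans (fillHook-leg T si*) gi* ,
      λ k sk t → trans (setArm-arm f T₁ sk)
        (dec-true (allOnes? T g k) (λ i si gi → least-support i (si , gi) k sk (trans (sym (fillHook-inner T si* sk)) t)))
    ¬meet : ¬ MeetingLegZero (fillHook T)
    ¬meet (i , si , ti , k , sk , tk) =
      clash (dec-true (rowMeetsArm? T i) (k , sk , trans (sym (fillHook-inner T si sk)) tk)) (trans (sym (fillHook-leg T si)) ti)
    F = fillHook T
    cleared : clearHook (fillHook T) ≡ T
    cleared = hook-ext (λ k sk → trans (setArm-arm _ (clearLeg F) sk) (sym (arm0 k sk)))
                       (λ i si → trans (setArm-col-c _ (clearLeg F)) (trans (setLeg-leg _ F si) (sym (leg0 i si))))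
                       (λ ¬arm ¬leg → trans (setArm-off _ (clearLeg F) ¬arm) (trans (setLeg-off _ F ¬leg)
                                        (trans (setArm-off f T₁ ¬arm) (setLeg-off g T ¬leg))))

  block∘unblock : ∀ T → Blocked T → block (unblock T) ≡ T
  block∘unblock T b@(_ , zero , _) = by-cases (legZero? T) (armZero? T) zero
    where
    by-cases : Dec (LegZero T) → Dec (ArmZero T) → HookZero T → block (unblock T) ≡ T
    by-cases (yes leg0) (no ¬arm0) _         = trans (cong block (unblock-leg T leg0 ¬arm0)) (block-fillLeg T leg0)
    by-cases (yes leg0) (yes arm0) _         = trans (cong block (unblock-hook T leg0 arm0)) (block-fillHook T b arm0 leg0)
    by-cases (no ¬leg0) _          (inj₁ arm0) = trans (cong block (unblock-arm T ¬leg0)) (block-fillArm T b arm0 ¬leg0)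
    by-cases (no ¬leg0) _          (inj₂ leg0) = ⊥-elim (¬leg0 leg0)

  unblock-clearLeg : ∀ T → Free T → ¬ DominatedLegOne T → unblock (clearLeg T) ≡ T
  unblock-clearLeg T (_ , (kr , skr , tkr) , _ , ext1 , _) ¬dom =
    trans (unblock-leg C leg0 (armHit⇒¬zero C (kr , skr , trans (setLeg-row-r _ T) tkr))) refilled
    where
    C = clearLeg T
    f = undominatedRow C
    leg0 : LegZero C
    leg0 i si = setLeg-leg _ T si
    undominated⇔one : ∀ i → Leg i → undominatedRow C i ≡ T [ i , c ]
    undominated⇔one i si = does-reflects (undominated? C i) one⇒undominated undominated⇒one
      where
      one⇒undominated : T [ i , c ] ≡ true → Undominated C i
      one⇒undominated ti with ¬dominated⇒undominated T i (λ dom → ¬dom (i , si , ti , dom))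
      ... | k , sk , tk , tr = k , sk , trans (setLeg-col≢c _ T (arm≢c sk)) tk , trans (setLeg-row-r _ T) tr
      undominated⇒one : Undominated C i → T [ i , c ] ≡ true
      undominated⇒one (k , sk , tk , tr) with bool-cases (T [ i , c ])
      ... | inj₁ ti = ti
      ... | inj₂ ti = ⊥-elim (clash (ext1 i k si sk (from-setLeg _ T (arm≢c sk) tk) ti) (trans (sym (setLeg-row-r _ T)) tr))
    refilled : fillLeg C ≡ T
    refilled = hook-ext (λ k sk → trans (setLeg-row-r f C) (setLeg-row-r _ T))
                        (λ i si → trans (setLeg-leg f C si) (undominated⇔one i si))
                        (λ _ ¬leg → trans (setLeg-off f C ¬leg) (setLeg-off _ T ¬leg))

  unblock-clearArm : ∀ T → Free T → DominatedLegOne T → unblock (clearArm T) ≡ T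
  unblock-clearArm T (_ , _ , (ic , sic , tic) , _ , ext0) (i* , si* , ti* , dominated) =
    trans (unblock-arm C (legHit⇒¬zero C (ic , sic , trans (setArm-col-c _ T) tic))) refilled
    where
    C = clearArm T
    f = onesUnder C (legValue C)
    ones⇔one : ∀ k → Arm k → f k ≡ T [ r , k ]
    ones⇔one k sk = does-reflects (allOnes? C (legValue C) k) one⇒ones ones⇒one
      where
      one⇒ones : T [ r , k ] ≡ true → AllOnes C (legValue C) k
      one⇒ones tr i si ti = trans (setArm-row≢r _ T (leg≢r si)) (ext0 i k si sk (trans (sym (setArm-col-c _ T)) ti) tr)
      ones⇒one : AllOnes C (legValue C) k → T [ r , k ] ≡ true
      ones⇒one ones = dominated k sk (from-setArm _ T (leg≢r si*) (ones i* si* (trans (setArm-col-c _ T) ti*)))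
    refilled : fillArm C ≡ T
    refilled = hook-ext (λ k sk → trans (setArm-arm f C sk) (ones⇔one k sk))
                        (λ i si → trans (setArm-col-c f C) (setArm-col-c _ T))
                        (λ ¬arm _ → trans (setArm-off f C ¬arm) (setArm-off _ T ¬arm))

  unblock-clearHook : ∀ T → Free T → DominatedLegOne T → ¬ MeetingLegZero T → unblock (clearHook T) ≡ T
  unblock-clearHook T (_ , (kr , skr , tkr) , _ , _ , ext0) (i* , si* , ti* , dominated) ¬meet =
    trans (unblock-hook C leg0 arm0) refilled
    where
    C = clearHook T
    leg0 : LegZero C
    leg0 i si = trans (setArm-col-c _ (clearLeg T)) (setLeg-leg _ T si)
    arm0 : ArmZero C
    arm0 k sk = setArm-arm _ (clearLeg T) sk
    inner : ∀ {i k} → Leg i → Arm k → C [ i , k ] ≡ T [ i , k ]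
    inner si sk = trans (setArm-row≢r _ (clearLeg T) (leg≢r si)) (setLeg-col≢c _ T (arm≢c sk))
    meets⇔one : ∀ i → Leg i → meetsArm C i ≡ T [ i , c ]
    meets⇔one i si = does-reflects (rowMeetsArm? C i)
      (λ ti → kr , skr , trans (inner si skr) (ext0 i kr si skr ti tkr))
      (λ { (k , sk , tk) → one-of-meeting (k , sk , trans (sym (inner si sk)) tk) })
      where
      one-of-meeting : RowMeetsArm T i → T [ i , c ] ≡ true
      one-of-meeting meets with bool-cases (T [ i , c ])
      ... | inj₁ ti = ti
      ... | inj₂ ti = ⊥-elim (¬meet (i , si , ti , meets))
    ones⇔one : ∀ k → Arm k → onesUnder C (meetsArm C) k ≡ T [ r , k ]
    ones⇔one k sk = does-reflects (allOnes? C (meetsArm C) k)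
      (λ tr i si mi → trans (inner si sk) (ext0 i k si sk (trans (sym (meets⇔one i si)) mi) tr))
      (λ ones → dominated k sk (trans (sym (inner si* sk)) (ones i* si* (trans (meets⇔one i* si*) ti*))))
    refilled : fillHook C ≡ T
    refilled = hook-ext (λ k sk → trans (setArm-arm _ (setLeg (meetsArm C) C) sk) (ones⇔one k sk))
                        (λ i si → trans (fillHook-leg C si) (meets⇔one i si))
                        (λ ¬arm ¬leg → trans (setArm-off _ (setLeg (meetsArm C) C) ¬arm) (trans (setLeg-off _ C ¬leg)
                                         (trans (setArm-off _ (clearLeg T) ¬arm) (setLeg-off _ T ¬leg))))

  unblock∘block : ∀ T → Free T → unblock (block T) ≡ T
  unblock∘block T free = by-cases (dominatedLegOne? T) (meetingLegZero? T)
    where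
    by-cases : Dec (DominatedLegOne T) → Dec (MeetingLegZero T) → unblock (block T) ≡ T
    by-cases (no ¬dom) _          = trans (cong unblock (block-leg T ¬dom)) (unblock-clearLeg T free ¬dom)
    by-cases (yes dom) (yes meet) = trans (cong unblock (block-arm T dom meet)) (unblock-clearArm T free dom)
    by-cases (yes dom) (no ¬meet) = trans (cong unblock (block-hook T dom ¬meet)) (unblock-clearHook T free dom ¬meet)

  zeroRow-setCorner : ∀ A v i → ZeroRow S (setCorner A v) i ⇔ (ZeroRow S⁻ A i × (i ≡ r → v ≡ false))
  zeroRow-setCorner A v i = mk⇔
    (λ zero → (λ j s → from-setCorner-S⁻ A v s (zero j (S⁻⊆S i j s))) ,
              (λ { refl → trans (sym (setCorner-corner A v)) (zero c corner∈S) }))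
    (λ (zero , at-r) j s → extend zero at-r j s)
    where
    extend : ZeroRow S⁻ A i → (i ≡ r → v ≡ false) → ZeroRow S (setCorner A v) i
    extend zero at-r j s with corner? i j
    ... | yes (refl , refl) = trans (setCorner-corner A v) (at-r refl)
    ... | no ¬corner        = trans (setCorner-other A v ¬corner) (zero j (to-S⁻ s ¬corner))

  zeroCol-setCorner : ∀ A v j → ZeroCol S (setCorner A v) j ⇔ (ZeroCol S⁻ A j × (j ≡ c → v ≡ false))
  zeroCol-setCorner A v j = mk⇔
    (λ zero → (λ i s → from-setCorner-S⁻ A v s (zero i (S⁻⊆S i j s))) ,
              (λ { refl → trans (sym (setCorner-corner A v)) (zero r corner∈S) }))
    (λ (zero , at-c) i s → extend zero at-c i s)
    where
    extend : ZeroCol S⁻ A j → (j ≡ c → v ≡ false) → ZeroCol S (setCorner A v) j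
    extend zero at-c i s with corner? i j
    ... | yes (refl , refl) = trans (setCorner-corner A v) (at-c refl)
    ... | no ¬corner        = trans (setCorner-other A v ¬corner) (zero i (to-S⁻ s ¬corner))

  SameZeros-setCorner : ∀ A B v → SameZeros S⁻ A B → SameZeros S (setCorner A v) (setCorner B v)
  SameZeros-setCorner A B v (same-zeros rows cols) = same-zeros
    (λ i → ⇔.trans (zeroRow-setCorner A v i) (⇔.trans (rows i ×-⇔ ⇔.refl) (⇔.sym (zeroRow-setCorner B v i))))
    (λ j → ⇔.trans (zeroCol-setCorner A v j) (⇔.trans (cols j ×-⇔ ⇔.refl) (⇔.sym (zeroCol-setCorner B v j))))

  hookZero-transfer : ∀ {A B} → SameZeros S⁻ A B → HookZero A → HookZero B
  hookZero-transfer same (inj₁ arm0) = inj₁ (Equivalence.to (SameZeros.rows same r) arm0)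
  hookZero-transfer same (inj₂ leg0) = inj₂ (Equivalence.to (SameZeros.cols same c) leg0)

  corner-irrelevant : ∀ A → ArmHit A → LegHit A → SameZeros S (setCorner A false) (setCorner A true)
  corner-irrelevant A armHit legHit = same-zeros
    (λ i → ⇔.trans (zeroRow-setCorner A false i) (⇔.trans row (⇔.sym (zeroRow-setCorner A true i))))
    (λ j → ⇔.trans (zeroCol-setCorner A false j) (⇔.trans col (⇔.sym (zeroCol-setCorner A true j))))
    where
    row : ∀ {i} → (ZeroRow S⁻ A i × (i ≡ r → false ≡ false)) ⇔ (ZeroRow S⁻ A i × (i ≡ r → true ≡ false))
    row = mk⇔ (λ (zero , _) → zero , λ { refl → ⊥-elim (armHit⇒¬zero A armHit zero) }) (λ (zero , _) → zero , λ _ → refl)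
    col : ∀ {j} → (ZeroCol S⁻ A j × (j ≡ c → false ≡ false)) ⇔ (ZeroCol S⁻ A j × (j ≡ c → true ≡ false))
    col = mk⇔ (λ (zero , _) → zero , λ { refl → ⊥-elim (legHit⇒¬zero A legHit zero) }) (λ (zero , _) → zero , λ _ → refl)

  -- block only turns hook entries to 0, and the cleared lines of a Free
  -- diagram never carry the last 1 of a row or column.
  block-zero : ∀ T {i j} → T [ i , j ] ≡ false → block T [ i , j ] ≡ false
  block-zero T = by-cases (dominatedLegOne? T) (meetingLegZero? T)
    where
    by-cases : ∀ dDom dMeet {i j} → T [ i , j ] ≡ false → block-by T dDom dMeet [ i , j ] ≡ false
    by-cases (no _)  _       t = overwrite-zero legCell? T t
    by-cases (yes _) (yes _) t = overwrite-zero armCell? T t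
    by-cases (yes _) (no _)  t = overwrite-zero armCell? (clearLeg T) (overwrite-zero legCell? T t)

  block-off-hook : ∀ T {i j} → i ≢ r → j ≢ c → block T [ i , j ] ≡ T [ i , j ]
  block-off-hook T = by-cases (dominatedLegOne? T) (meetingLegZero? T)
    where
    by-cases : ∀ dDom dMeet {i j} → i ≢ r → j ≢ c → block-by T dDom dMeet [ i , j ] ≡ T [ i , j ]
    by-cases (no _)  _       i≢r j≢c = setLeg-col≢c _ T j≢c
    by-cases (yes _) (yes _) i≢r j≢c = setArm-row≢r _ T i≢r
    by-cases (yes _) (no _)  i≢r j≢c = trans (setArm-row≢r _ (clearLeg T) i≢r) (setLeg-col≢c _ T j≢c)

  block-zeros : ∀ T → Free T → SameZeros S (setCorner (block T) true) (setCorner T false)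
  block-zeros T (_ , (kr , skr , tkr) , (ic , sic , tic) , _ , ext0) = same-zeros rows cols
    where
    B = block T
    rows : ∀ i → ZeroRow S (setCorner B true) i ⇔ ZeroRow S (setCorner T false) i
    rows i = ⇔.trans (zeroRow-setCorner B true i) (⇔.trans (mk⇔ to from) (⇔.sym (zeroRow-setCorner T false i)))
      where
      to : ZeroRow S⁻ B i × (i ≡ r → true ≡ false) → ZeroRow S⁻ T i × (i ≡ r → false ≡ false)
      to (zero , at-r) = zero-T , λ _ → refl
        where
        i≢r : i ≢ r
        i≢r i≡r = clash refl (at-r i≡r)
        zero-T : ZeroRow S⁻ T i
        zero-T j s with bool-cases (T [ i , j ]) | j F.≟ c
        ... | inj₂ t | _        = t
        ... | inj₁ t | no j≢c   = ⊥-elim (clash (trans (block-off-hook T i≢r j≢c) t) (zero j s))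
        ... | inj₁ t | yes refl = ⊥-elim (clash (trans (block-off-hook T i≢r (arm≢c skr)) (ext0 i kr s skr t tkr))
                                                 (zero kr (hook-fill s skr)))
      from : ZeroRow S⁻ T i × (i ≡ r → false ≡ false) → ZeroRow S⁻ B i × (i ≡ r → true ≡ false)
      from (zero , _) = (λ j s → block-zero T (zero j s)) , λ { refl → ⊥-elim (armHit⇒¬zero T (kr , skr , tkr) zero) }
    cols : ∀ j → ZeroCol S (setCorner B true) j ⇔ ZeroCol S (setCorner T false) j
    cols j = ⇔.trans (zeroCol-setCorner B true j) (⇔.trans (mk⇔ to from) (⇔.sym (zeroCol-setCorner T false j)))
      where
      to : ZeroCol S⁻ B j × (j ≡ c → true ≡ false) → ZeroCol S⁻ T j × (j ≡ c → false ≡ false)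
      to (zero , at-c) = zero-T , λ _ → refl
        where
        j≢c : j ≢ c
        j≢c j≡c = clash refl (at-c j≡c)
        zero-T : ZeroCol S⁻ T j
        zero-T i s with bool-cases (T [ i , j ]) | i F.≟ r
        ... | inj₂ t | _        = t
        ... | inj₁ t | no i≢r   = ⊥-elim (clash (trans (block-off-hook T i≢r j≢c) t) (zero i s))
        ... | inj₁ t | yes refl = ⊥-elim (clash (trans (block-off-hook T (leg≢r sic) j≢c) (ext0 ic j sic s tic t))
                                                 (zero ic (hook-fill sic s)))
      from : ZeroCol S⁻ T j × (j ≡ c → false ≡ false) → ZeroCol S⁻ B j × (j ≡ c → true ≡ false)
      from (zero , _) = (λ i s → block-zero T (zero i s)) , λ { refl → ⊥-elim (legHit⇒¬zero T (ic , sic , tic) zero) }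

  X-restrict : ∀ T → IsXDiagram S T → XDiagram S⁻ (restrict T)
  X-restrict T x with IsX⇒XDiagram {S = S} {M = T} x
  ... | d , free = diagram-restrict T d , crossingFree-restrict T false free

  X-extend : ∀ A v → XDiagram S⁻ A → (v ≡ true → Ext1 A) → (v ≡ false → Ext0 A) → IsXDiagram S (setCorner A v)
  X-extend A v (d , free) ext1 ext0 =
    XDiagram⇒IsX {S = S} {M = setCorner A v} (diagram-extend A v d , crossingFree-extend A v free ext1 ext0)

  restriction-free : ∀ T → IsXDiagram S T → T [ r , c ] ≡ false → ¬ HookZero (restrict T) → ¬ Obstr1 (restrict T) → Free (restrict T)
  restriction-free T x t₀ ¬zero ¬ob =
    X-restrict T x , ¬armZero⇒hit T₀ (¬zero ∘ inj₁) , ¬legZero⇒hit T₀ (¬zero ∘ inj₂) , ¬obstr1⇒ext1 T₀ ¬ob ,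
    corner0⇒ext0 T (proj₂ (IsX⇒XDiagram {S = S} {M = T} x)) t₀
    where T₀ = restrict T

  module Extend (IH : Correspondence S⁻) where
    open Correspondence IH renaming (φ to φ⁻; ψ to ψ⁻; φ-Γ to φ⁻-Γ; ψ-X to ψ⁻-X; ψ∘φ to ψ⁻∘φ⁻; φ∘ψ to φ⁻∘ψ⁻; φ-zeros to φ⁻-zeros)

    φ-by : ∀ A → Bool → Dec (HookZero A) → Dec (Obstr1 A) → Matrix m n
    φ-by A true  _       _       = setCorner (φ⁻ A) true
    φ-by A false (yes _) _       = setCorner (φ⁻ A) false
    φ-by A false (no _)  (yes _) = setCorner (φ⁻ A) true
    φ-by A false (no _)  (no _)  = setCorner (φ⁻ (block A)) true

    φ-from : Matrix m n → Bool → Matrix m n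
    φ-from A v = φ-by A v (hookZero? A) (obstr1? A)

    φ : Matrix m n → Matrix m n
    φ T = φ-from (restrict T) (T [ r , c ])

    ψ-by : ∀ A → Bool → Dec (Obstr1 A) → Dec (HookZero A) → Matrix m n
    ψ-by A false _       _       = setCorner A false
    ψ-by A true  (no _)  _       = setCorner A true
    ψ-by A true  (yes _) (no _)  = setCorner A false
    ψ-by A true  (yes _) (yes _) = setCorner (unblock A) false

    ψ-from : Matrix m n → Bool → Matrix m n
    ψ-from A v = ψ-by A v (obstr1? A) (hookZero? A)

    ψ : Matrix m n → Matrix m n
    ψ U = ψ-from (ψ⁻ (restrict U)) (U [ r , c ])

    data φ-Case (T R : Matrix m n) : Set where
      φ-one        : T [ r , c ] ≡ true → Ext1 (restrict T) →
                     R ≡ setCorner (φ⁻ (restrict T)) true → φ-Case T R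
      φ-zero-hook  : T [ r , c ] ≡ false → HookZero (restrict T) →
                     R ≡ setCorner (φ⁻ (restrict T)) false → φ-Case T R
      φ-obstructed : T [ r , c ] ≡ false → ¬ HookZero (restrict T) → Obstr1 (restrict T) →
                     R ≡ setCorner (φ⁻ (restrict T)) true → φ-Case T R
      φ-free       : T [ r , c ] ≡ false → Free (restrict T) →
                     R ≡ setCorner (φ⁻ (block (restrict T))) true → φ-Case T R

    φ-case : ∀ T → IsXDiagram S T → φ-Case T (φ T)
    φ-case T x = by-cases (T [ r , c ]) refl (hookZero? T₀) (obstr1? T₀)
      where
      T₀ = restrict T
      free-T : CrossingFree S T
      free-T = proj₂ (IsX⇒XDiagram {S = S} {M = T} x)
      by-cases : ∀ v → T [ r , c ] ≡ v → ∀ dZero dOb → φ-Case T (φ-by T₀ v dZero dOb)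
      by-cases true  t₁ _           _          = φ-one t₁ (corner1⇒ext1 T free-T t₁) refl
      by-cases false t₀ (yes zero)  _          = φ-zero-hook t₀ zero refl
      by-cases false t₀ (no ¬zero)  (yes ob)   = φ-obstructed t₀ ¬zero ob refl
      by-cases false t₀ (no ¬zero)  (no ¬ob)   = φ-free t₀ (restriction-free T x t₀ ¬zero ¬ob) refl

    module Restriction (U : Matrix m n) (γ : IsΓDiagram S U) where
      U₀ = restrict U
      γ₀ = Γ-restrict U γ
      A  = ψ⁻ U₀
      xA : XDiagram S⁻ A
      xA = IsX⇒XDiagram {S = S⁻} {M = A} (ψ⁻-X U₀ γ₀)
      back : ∀ {v} → U [ r , c ] ≡ v → setCorner (φ⁻ A) v ≡ U
      back u = trans (cong (λ B → setCorner B _) (φ⁻∘ψ⁻ U₀ γ₀)) (restore U u)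

    data ψ-Case (U R : Matrix m n) : Set where
      ψ-zero       : U [ r , c ] ≡ false → HookZero (ψ⁻ (restrict U)) →
                     R ≡ setCorner (ψ⁻ (restrict U)) false → ψ-Case U R
      ψ-extends    : U [ r , c ] ≡ true → Ext1 (ψ⁻ (restrict U)) →
                     R ≡ setCorner (ψ⁻ (restrict U)) true → ψ-Case U R
      ψ-obstructed : U [ r , c ] ≡ true → Obstr1 (ψ⁻ (restrict U)) → ¬ HookZero (ψ⁻ (restrict U)) →
                     R ≡ setCorner (ψ⁻ (restrict U)) false → ψ-Case U R
      ψ-blocked    : U [ r , c ] ≡ true → Blocked (ψ⁻ (restrict U)) →
                     R ≡ setCorner (unblock (ψ⁻ (restrict U))) false → ψ-Case U R

    ψ-case : ∀ U → IsΓDiagram S U → ψ-Case U (ψ U)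
    ψ-case U γ = by-cases (U [ r , c ]) refl (obstr1? A) (hookZero? A)
      where
      open Restriction U γ
      by-cases : ∀ v → U [ r , c ] ≡ v → ∀ dOb dZero → ψ-Case U (ψ-by A v dOb dZero)
      by-cases false u₀ _        _          =
        ψ-zero u₀ (hookZero-transfer (SameZeros-sym (φ⁻-zeros A (ψ⁻-X U₀ γ₀)))
                                    (subst HookZero (sym (φ⁻∘ψ⁻ U₀ γ₀)) (Γ-corner0⇒hookZero U γ u₀))) refl
      by-cases true  u₁ (no ¬ob) _          = ψ-extends u₁ (¬obstr1⇒ext1 A ¬ob) refl
      by-cases true  u₁ (yes ob) (no ¬zero) = ψ-obstructed u₁ ob ¬zero refl
      by-cases true  u₁ (yes ob) (yes zero) = ψ-blocked u₁ (xA , zero , ob) refl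

    φ-setCorner : ∀ A v → IsDiagram S⁻ A → φ (setCorner A v) ≡ φ-from A v
    φ-setCorner A v d = cong₂ φ-from (trans (setCorner-twice A v false) (setCorner-id A d)) (setCorner-corner A v)

    ψ-setCorner : ∀ V v → IsDiagram S⁻ V → ψ (setCorner V v) ≡ ψ-from (ψ⁻ V) v
    ψ-setCorner V v d = cong₂ (λ W → ψ-from (ψ⁻ W)) (trans (setCorner-twice V v false) (setCorner-id V d)) (setCorner-corner V v)

    ψ-after-φ⁻ : ∀ A v → IsXDiagram S⁻ A → ψ (setCorner (φ⁻ A) v) ≡ ψ-from A v
    ψ-after-φ⁻ A v x = trans (ψ-setCorner (φ⁻ A) v (proj₁ (φ⁻-Γ A x))) (cong (λ B → ψ-from B v) (ψ⁻∘φ⁻ A x))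

    φ-from-zero-hook : ∀ A → HookZero A → φ-from A false ≡ setCorner (φ⁻ A) false
    φ-from-zero-hook A zero = by-cases (hookZero? A) (obstr1? A)
      where
      by-cases : ∀ dZero dOb → φ-by A false dZero dOb ≡ setCorner (φ⁻ A) false
      by-cases (yes _)    _ = refl
      by-cases (no ¬zero) _ = ⊥-elim (¬zero zero)

    φ-from-obstructed : ∀ A → ¬ HookZero A → Obstr1 A → φ-from A false ≡ setCorner (φ⁻ A) true
    φ-from-obstructed A ¬zero ob = by-cases (hookZero? A) (obstr1? A)
      where
      by-cases : ∀ dZero dOb → φ-by A false dZero dOb ≡ setCorner (φ⁻ A) true
      by-cases (yes zero) _         = ⊥-elim (¬zero zero)
      by-cases (no _)     (yes _)   = refl
      by-cases (no _)     (no ¬ob)  = ⊥-elim (¬ob ob)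

    φ-from-free : ∀ A → Free A → φ-from A false ≡ setCorner (φ⁻ (block A)) true
    φ-from-free A free@(_ , _ , _ , ext1 , _) = by-cases (hookZero? A) (obstr1? A)
      where
      by-cases : ∀ dZero dOb → φ-by A false dZero dOb ≡ setCorner (φ⁻ (block A)) true
      by-cases (yes zero) _        = ⊥-elim (free⇒¬hookZero A free zero)
      by-cases (no _)     (yes ob) = ⊥-elim (ext1⇒¬obstr1 A ext1 ob)
      by-cases (no _)     (no _)   = refl

    ψ-from-extends : ∀ A → Ext1 A → ψ-from A true ≡ setCorner A true
    ψ-from-extends A ext1 = by-cases (obstr1? A) (hookZero? A)
      where
      by-cases : ∀ dOb dZero → ψ-by A true dOb dZero ≡ setCorner A true
      by-cases (no _)   _ = refl
      by-cases (yes ob) _ = ⊥-elim (ext1⇒¬obstr1 A ext1 ob)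

    ψ-from-obstructed : ∀ A → Obstr1 A → ¬ HookZero A → ψ-from A true ≡ setCorner A false
    ψ-from-obstructed A ob ¬zero = by-cases (obstr1? A) (hookZero? A)
      where
      by-cases : ∀ dOb dZero → ψ-by A true dOb dZero ≡ setCorner A false
      by-cases (no ¬ob) _          = ⊥-elim (¬ob ob)
      by-cases (yes _)  (no _)     = refl
      by-cases (yes _)  (yes zero) = ⊥-elim (¬zero zero)

    ψ-from-blocked : ∀ A → Blocked A → ψ-from A true ≡ setCorner (unblock A) false
    ψ-from-blocked A (_ , zero , ob) = by-cases (obstr1? A) (hookZero? A)
      where
      by-cases : ∀ dOb dZero → ψ-by A true dOb dZero ≡ setCorner (unblock A) false
      by-cases (no ¬ob) _          = ⊥-elim (¬ob ob)
      by-cases (yes _)  (no ¬zero) = ⊥-elim (¬zero zero)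
      by-cases (yes _)  (yes _)    = refl

    X₀ : ∀ T → IsXDiagram S T → IsXDiagram S⁻ (restrict T)
    X₀ T x = XDiagram⇒IsX {S = S⁻} {M = restrict T} (X-restrict T x)

    X-block : ∀ A → Free A → IsXDiagram S⁻ (block A)
    X-block A fr = XDiagram⇒IsX {S = S⁻} {M = block A} (proj₁ (block-blocked A fr))

    φ-Γ : ∀ T → IsXDiagram S T → IsΓDiagram S (φ T)
    φ-Γ T x with φ-case T x
    ... | φ-one _ _ eq = subst (IsΓDiagram S) (sym eq) (Γ-extend (φ⁻ T₀) true (φ⁻-Γ T₀ (X₀ T x)) λ ())
      where T₀ = restrict T
    ... | φ-zero-hook _ zero eq =
      subst (IsΓDiagram S) (sym eq) (Γ-extend (φ⁻ T₀) false (φ⁻-Γ T₀ (X₀ T x)) λ _ → hookZero-transfer (φ⁻-zeros T₀ (X₀ T x)) zero)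
      where T₀ = restrict T
    ... | φ-obstructed _ _ _ eq = subst (IsΓDiagram S) (sym eq) (Γ-extend (φ⁻ T₀) true (φ⁻-Γ T₀ (X₀ T x)) λ ())
      where T₀ = restrict T
    ... | φ-free _ fr eq = subst (IsΓDiagram S) (sym eq) (Γ-extend (φ⁻ (block T₀)) true (φ⁻-Γ (block T₀) (X-block T₀ fr)) λ ())
      where T₀ = restrict T

    ψ-X : ∀ U → IsΓDiagram S U → IsXDiagram S (ψ U)
    ψ-X U γ with ψ-case U γ
    ... | ψ-zero _ zero eq = subst (IsXDiagram S) (sym eq) (X-extend A false xA (λ ()) λ _ → hookZero⇒ext0 A zero)
      where open Restriction U γ
    ... | ψ-extends _ ext1 eq = subst (IsXDiagram S) (sym eq) (X-extend A true xA (λ _ → ext1) λ ())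
      where open Restriction U γ
    ... | ψ-obstructed _ ob _ eq = subst (IsXDiagram S) (sym eq) (X-extend A false xA (λ ()) λ _ → obstr1⇒ext0 A (proj₂ xA) ob)
      where open Restriction U γ
    ... | ψ-blocked _ b eq = subst (IsXDiagram S) (sym eq) (X-extend (unblock A) false (proj₁ fr) (λ ()) λ _ → ext0)
      where open Restriction U γ
            fr = unblock-free A b
            ext0 = proj₂ (proj₂ (proj₂ (proj₂ fr)))

    lift : ∀ A v → IsXDiagram S⁻ A → SameZeros S (setCorner A v) (setCorner (φ⁻ A) v)
    lift A v x = SameZeros-setCorner A (φ⁻ A) v (φ⁻-zeros A x)

    open ≡-Reasoning

    ψ∘φ : ∀ T → IsXDiagram S T → ψ (φ T) ≡ T
    ψ∘φ T x with φ-case T x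
    ... | φ-one t₁ ext1 eq = begin
      ψ (φ T)                         ≡⟨ cong ψ eq ⟩
      ψ (setCorner (φ⁻ T₀) true)      ≡⟨ ψ-after-φ⁻ T₀ true (X₀ T x) ⟩
      ψ-from T₀ true                  ≡⟨ ψ-from-extends T₀ ext1 ⟩
      setCorner T₀ true               ≡⟨ restore T t₁ ⟩
      T                               ∎
      where T₀ = restrict T
    ... | φ-zero-hook t₀ _ eq = begin
      ψ (φ T)                         ≡⟨ cong ψ eq ⟩
      ψ (setCorner (φ⁻ T₀) false)     ≡⟨ ψ-after-φ⁻ T₀ false (X₀ T x) ⟩
      setCorner T₀ false              ≡⟨ restore T t₀ ⟩
      T                               ∎
      where T₀ = restrict T
    ... | φ-obstructed t₀ ¬zero ob eq = begin
      ψ (φ T)                         ≡⟨ cong ψ eq ⟩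
      ψ (setCorner (φ⁻ T₀) true)      ≡⟨ ψ-after-φ⁻ T₀ true (X₀ T x) ⟩
      ψ-from T₀ true                  ≡⟨ ψ-from-obstructed T₀ ob ¬zero ⟩
      setCorner T₀ false              ≡⟨ restore T t₀ ⟩
      T                               ∎
      where T₀ = restrict T
    ... | φ-free t₀ fr eq = begin
      ψ (φ T)                           ≡⟨ cong ψ eq ⟩
      ψ (setCorner (φ⁻ (block T₀)) true) ≡⟨ ψ-after-φ⁻ (block T₀) true (X-block T₀ fr) ⟩
      ψ-from (block T₀) true            ≡⟨ ψ-from-blocked (block T₀) (block-blocked T₀ fr) ⟩
      setCorner (unblock (block T₀)) false ≡⟨ cong (λ B → setCorner B false) (unblock∘block T₀ fr) ⟩
      setCorner T₀ false                ≡⟨ restore T t₀ ⟩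
      T                                 ∎
      where T₀ = restrict T

    φ∘ψ : ∀ U → IsΓDiagram S U → φ (ψ U) ≡ U
    φ∘ψ U γ with ψ-case U γ
    ... | ψ-zero u₀ zero eq = begin
      φ (ψ U)                      ≡⟨ cong φ eq ⟩
      φ (setCorner A false)        ≡⟨ φ-setCorner A false (proj₁ xA) ⟩
      φ-from A false               ≡⟨ φ-from-zero-hook A zero ⟩
      setCorner (φ⁻ A) false       ≡⟨ back u₀ ⟩
      U                            ∎
      where open Restriction U γ
    ... | ψ-extends u₁ _ eq = begin
      φ (ψ U)                      ≡⟨ cong φ eq ⟩
      φ (setCorner A true)         ≡⟨ φ-setCorner A true (proj₁ xA) ⟩
      setCorner (φ⁻ A) true        ≡⟨ back u₁ ⟩
      U                            ∎
      where open Restriction U γ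
    ... | ψ-obstructed u₁ ob ¬zero eq = begin
      φ (ψ U)                      ≡⟨ cong φ eq ⟩
      φ (setCorner A false)        ≡⟨ φ-setCorner A false (proj₁ xA) ⟩
      φ-from A false               ≡⟨ φ-from-obstructed A ¬zero ob ⟩
      setCorner (φ⁻ A) true        ≡⟨ back u₁ ⟩
      U                            ∎
      where open Restriction U γ
    ... | ψ-blocked u₁ b eq = begin
      φ (ψ U)                               ≡⟨ cong φ eq ⟩
      φ (setCorner (unblock A) false)       ≡⟨ φ-setCorner (unblock A) false (proj₁ (proj₁ fr)) ⟩
      φ-from (unblock A) false              ≡⟨ φ-from-free (unblock A) fr ⟩
      setCorner (φ⁻ (block (unblock A))) true ≡⟨ cong (λ B → setCorner (φ⁻ B) true) (block∘unblock A b) ⟩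
      setCorner (φ⁻ A) true                 ≡⟨ back u₁ ⟩
      U                                     ∎
      where open Restriction U γ
            fr = unblock-free A b

    φ-zeros : ∀ T → IsXDiagram S T → SameZeros S T (φ T)
    φ-zeros T x with φ-case T x
    ... | φ-one t₁ _ eq = subst₂ (SameZeros S) (restore T t₁) (sym eq) (lift T₀ true (X₀ T x))
      where T₀ = restrict T
    ... | φ-zero-hook t₀ _ eq = subst₂ (SameZeros S) (restore T t₀) (sym eq) (lift T₀ false (X₀ T x))
      where T₀ = restrict T
    ... | φ-obstructed t₀ ¬zero _ eq = subst₂ (SameZeros S) (restore T t₀) (sym eq)
      (SameZeros-trans (corner-irrelevant T₀ (¬armZero⇒hit T₀ (¬zero ∘ inj₁)) (¬legZero⇒hit T₀ (¬zero ∘ inj₂)))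
                       (lift T₀ true (X₀ T x)))
      where T₀ = restrict T
    ... | φ-free t₀ fr eq = subst₂ (SameZeros S) (restore T t₀) (sym eq)
      (SameZeros-trans (SameZeros-sym (block-zeros T₀ fr)) (lift (block T₀) true (X-block T₀ fr)))
      where T₀ = restrict T

    correspondence : Correspondence S
    correspondence = record { φ = φ ; ψ = ψ ; φ-Γ = φ-Γ ; ψ-X = ψ-X ; ψ∘φ = ψ∘φ ; φ∘ψ = φ∘ψ ; φ-zeros = φ-zeros }

-- Cells in reading order: (i , j) sits at position pos i j = n·i + j.
-- The prefixes of S in this order are Γ-complete, and each nonempty step
-- adds one cell that is last in its prefix.
module ReadingOrder {m n : ℕ} where

  pos : Fin m → Fin n → ℕ
  pos i j = F.toℕ (F.combine i j)

  pos-injective : ∀ {i j r k} → pos i j ≡ pos r k → i ≡ r × j ≡ k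
  pos-injective {i} {j} {r} {k} e = FP.combine-injective i j r k (FP.toℕ-injective e)

  pos-mono : ∀ {i r} j k → i < r → pos i j ℕ.< pos r k
  pos-mono j k = FP.combine-monoˡ-< j k

  pos-lex : ∀ i j r k → pos i j ℕ.≤ pos r k → i < r ⊎ (i ≡ r × j F.≤ k)
  pos-lex i j r k le with FP.<-cmp i r
  ... | tri< i<r _ _  = inj₁ i<r
  ... | tri≈ _ refl _ = inj₂ (refl , ℕP.+-cancelˡ-≤ (n ℕ.* F.toℕ i) _ _ (subst₂ ℕ._≤_ (FP.toℕ-combine i j) (FP.toℕ-combine i k) le))
  ... | tri> _ _ r<i  = ⊥-elim (ℕP.<⇒≱ (pos-mono k j r<i) le)

  Later : ℕ → Fin m → Fin n → Set
  Later p i j = p ℕ.≤ pos i j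

  later? : ∀ p i j → Dec (Later p i j)
  later? p i j = p ℕP.≤? pos i j

  prefix : Polyomino m n → ℕ → Polyomino m n
  prefix S p = overwrite (later? p) (λ _ _ → false) S

  prefix-inside : ∀ S p {i j} → pos i j ℕ.< p → prefix S p [ i , j ] ≡ S [ i , j ]
  prefix-inside S p lt = overwrite-outside (later? p) _ S (ℕP.<⇒≱ lt)

  prefix-outside : ∀ S p {i j} → p ℕ.≤ pos i j → prefix S p [ i , j ] ≡ false
  prefix-outside S p le = overwrite-inside (later? p) _ S le

  prefix-cell : ∀ S p {i j} → prefix S p [ i , j ] ≡ true → S [ i , j ] ≡ true × pos i j ℕ.< p
  prefix-cell S p {i} {j} s with p ℕP.≤? pos i j
  ... | yes p≤ = ⊥-elim (clash s (prefix-outside S p p≤))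
  ... | no p≰  = trans (sym (prefix-inside S p (ℕP.≰⇒> p≰))) s , ℕP.≰⇒> p≰

  prefix-ΓComplete : ∀ S p → ΓComplete S → ΓComplete (prefix S p)
  prefix-ΓComplete S p Γcomp i i' k l i<i' k<l s₁ s₂ s₃ =
    trans (prefix-inside S p (ℕP.<-trans (pos-mono k k i<i') (proj₂ (prefix-cell S p s₁))))
          (Γcomp i i' k l i<i' k<l (proj₁ (prefix-cell S p s₁)) (proj₁ (prefix-cell S p s₂)) (proj₁ (prefix-cell S p s₃)))

  prefix-unchanged : ∀ S p → (∀ i j → pos i j ≡ p → S [ i , j ] ≡ false) → prefix S (ℕ.suc p) ≡ prefix S p
  prefix-unchanged S p none = matrix-ext cell
    where
    cell : ∀ i j → prefix S (ℕ.suc p) [ i , j ] ≡ prefix S p [ i , j ]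
    cell i j with ℕP.<-cmp (pos i j) p
    ... | tri< lt _ _ = trans (prefix-inside S (ℕ.suc p) (ℕP.m<n⇒m<1+n lt)) (sym (prefix-inside S p lt))
    ... | tri≈ _ e _  = trans (prefix-inside S (ℕ.suc p) (ℕP.≤-reflexive (cong ℕ.suc e))) (trans (none i j e) (sym (prefix-outside S p (ℕP.≤-reflexive (sym e)))))
    ... | tri> _ _ gt = trans (prefix-outside S (ℕ.suc p) gt) (sym (prefix-outside S p (ℕP.<⇒≤ gt)))

  prefix-grows : ∀ S p → ΓComplete S → ∀ r c → pos r c ≡ p → S [ r , c ] ≡ true →
    Correspondence (prefix S p) → Correspondence (prefix S (ℕ.suc p))
  prefix-grows S p Γcomp r c e s IH =
    CornerStep.Extend.correspondence S₊ S₋ r c corner∈S₊ corner∉S₋ S₋⊆S₊ S₊⊆S₋+corner corner-last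
      (prefix-ΓComplete S (ℕ.suc p) Γcomp) IH
    where
    S₊ = prefix S (ℕ.suc p)
    S₋ = prefix S p
    corner∈S₊ : S₊ [ r , c ] ≡ true
    corner∈S₊ = trans (prefix-inside S (ℕ.suc p) (ℕP.≤-reflexive (cong ℕ.suc e))) s
    corner∉S₋ : S₋ [ r , c ] ≡ false
    corner∉S₋ = prefix-outside S p (ℕP.≤-reflexive (sym e))
    S₋⊆S₊ : ∀ i j → S₋ [ i , j ] ≡ true → S₊ [ i , j ] ≡ true
    S₋⊆S₊ i j s₋ with prefix-cell S p s₋
    ... | s , lt = trans (prefix-inside S (ℕ.suc p) (ℕP.m<n⇒m<1+n lt)) s
    S₊⊆S₋+corner : ∀ i j → S₊ [ i , j ] ≡ true → (i ≡ r × j ≡ c) ⊎ S₋ [ i , j ] ≡ true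
    S₊⊆S₋+corner i j s₊ with prefix-cell S (ℕ.suc p) s₊
    ... | s , lt with ℕP.m≤n⇒m<n∨m≡n (ℕP.≤-pred lt)
    ...   | inj₁ lt' = inj₂ (trans (prefix-inside S p lt') s)
    ...   | inj₂ e'  = inj₁ (pos-injective (trans e' (sym e)))
    corner-last : ∀ i j → S₊ [ i , j ] ≡ true → i < r ⊎ (i ≡ r × j F.≤ c)
    corner-last i j s₊ = pos-lex i j r c (subst (pos i j ℕ.≤_) (sym e) (ℕP.≤-pred (proj₂ (prefix-cell S (ℕ.suc p) s₊))))

  prefix-correspondence : ∀ S → ΓComplete S → ∀ p → Correspondence (prefix S p)
  prefix-correspondence S Γcomp ℕ.zero = empty-correspondence (prefix S ℕ.zero) (λ i j → prefix-outside S ℕ.zero ℕ.z≤n)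
  prefix-correspondence S Γcomp (ℕ.suc p)
    with FP.any? (λ r → FP.any? (λ c → (pos r c ℕP.≟ p) ×-dec (S [ r , c ] ≟ᵇ true)))
  ... | yes (r , c , e , s) = prefix-grows S p Γcomp r c e s (prefix-correspondence S Γcomp p)
  ... | no ¬cell = subst Correspondence (sym (prefix-unchanged S p none)) (prefix-correspondence S Γcomp p)
    where
    none : ∀ i j → pos i j ≡ p → S [ i , j ] ≡ false
    none i j e with bool-cases (S [ i , j ])
    ... | inj₁ s = ⊥-elim (¬cell (i , j , e , s))
    ... | inj₂ s = s

  prefix-whole : ∀ S → prefix S (m ℕ.* n) ≡ S
  prefix-whole S = matrix-ext λ i j → prefix-inside S (m ℕ.* n) (FP.toℕ<n (F.combine i j))

correspondence : ∀ {m n} (S : Polyomino m n) → ΓComplete S → Correspondence S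
correspondence {m} {n} S Γcomp = subst Correspondence (prefix-whole S) (prefix-correspondence S Γcomp (m ℕ.* n))
  where open ReadingOrder

proposition4p6 : ∀ (m n : ℕ) (S : Polyomino m n) → ΓComplete S →
    Σ[ φ ∈ (Matrix m n → Matrix m n) ]
      ((∀ T → IsXDiagram S T → IsΓDiagram S (φ T))
      × (∀ T T' → IsXDiagram S T → IsXDiagram S T' → φ T ≡ φ T' → T ≡ T')
      × (∀ U → IsΓDiagram S U → Σ[ T ∈ Matrix m n ] (IsXDiagram S T × φ T ≡ U))
      × (∀ T → IsXDiagram S T →
           (∀ i → ZeroRow S T i ⇔ ZeroRow S (φ T) i)
           × (∀ j → ZeroCol S T j ⇔ ZeroCol S (φ T) j)))
proposition4p6 m n S Γcomp = φ , φ-Γ , injective , surjective , zeros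
  where
  open Correspondence (correspondence S Γcomp)
  open ≡-Reasoning

  injective : ∀ T T' → IsXDiagram S T → IsXDiagram S T' → φ T ≡ φ T' → T ≡ T'
  injective T T' x x' φT≡φT' = begin
    T          ≡⟨ ψ∘φ T x ⟨
    ψ (φ T)    ≡⟨ cong ψ φT≡φT' ⟩
    ψ (φ T')   ≡⟨ ψ∘φ T' x' ⟩
    T'         ∎

  surjective : ∀ U → IsΓDiagram S U → Σ[ T ∈ Matrix m n ] (IsXDiagram S T × φ T ≡ U)
  surjective U γ = ψ U , ψ-X U γ , φ∘ψ U γ

  zeros : ∀ T → IsXDiagram S T → (∀ i → ZeroRow S T i ⇔ ZeroRow S (φ T) i) × (∀ j → ZeroCol S T j ⇔ ZeroCol S (φ T) j)
  zeros T x = SameZeros.rows (φ-zeros T x) , SameZeros.cols (φ-zeros T x)
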